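{- Let $a_{\max}/a_{\min}\le 2$, where $a_{\min},a_{\max}$ are the minimum and maximum weights. Let $\alpha_i:=\min\{p_i,1-p_i\}$. Fix $I\subseteq[n]$ with $|I|=t$ and fix the permutation $\pi$. Then for every $k\in[t-1]$, conditioned on $\pi$, $\Pr[Z_k]\le\delta_k$, where $\delta_k:=\prod_{i=1}^{\lfloor|J_k|/2\rfloor}(1-\alpha_{j_{k,2i-1}}\alpha_{j_{k,2i}})$.
   Context: Input: $P=(p_1,\dots,p_n)\in[0,1]^n$ and weights $A=(a_1,\dots,a_n)$, all $a_i>0$. For $a_1,a_2>0$, $\beta_1,\beta_2\in(0,1)$, $\textsc{Simplify}(a_1,a_2,\beta_1,\beta_2)$ outputs $(\gamma_1,\gamma_2)$: let $s=a_1\beta_1+a_2\beta_2$ and apply the first case whose condition holds. Case I ($s\le\min\{a_1,a_2\}$): w.p. $a_2\beta_2/s$ set $\gamma_1=0$, otherwise $\gamma_2=0$. Case II ($a_1<s<a_2$): w.p. $\beta_1$ set $\gamma_1=1$, otherwise $\gamma_1=0$. Case III ($a_2<s<a_1$): w.p. $\beta_2$ set $\gamma_2=1$, otherwise $\gamma_2=0$. Case IV ($\max\{a_1,a_2\}\le s\le a_1+a_2$): w.p. $a_2(1-\beta_2)/(a_1(1-\beta_1)+a_2(1-\beta_2))$ set $\gamma_1=1$, otherwise $\gamma_2=1$. Then: if $\gamma_1=0$, $\gamma_2=\beta_2+\beta_1a_1/a_2$; if $\gamma_1=1$, $\gamma_2=\beta_2-(1-\beta_1)a_1/a_2$; if $\gamma_2=0$,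 $\gamma_1=\beta_1+\beta_2a_2/a_1$; if $\gamma_2=1$, $\gamma_1=\beta_1-(1-\beta_2)a_2/a_1$. $\textsc{DepRound}(P,A)$: set $X=P$; choose a uniformly random permutation $\pi$ of $[n]$; while $X$ has at least two entries in $(0,1)$, let $X_i,X_j$ be the two fractional entries earliest in the $\pi$-order (positions $\pi^{ -1}(\cdot)$; $X_i$ first) and replace $(X_i,X_j)$ by $\textsc{Simplify}(a_i,a_j,X_i,X_j)$ (a step); output $X$. Two variables are co-rounded if both are changed in the same step. Given $I\subseteq[n]$ of size $t$ and $\pi$, let $\sigma:[t]\to I$ be the bijection with $\pi^{ -1}(\sigma(1))<\dots<\pi^{ -1}(\sigma(t))$; set $\pi^{ -1}(\sigma(0)):=0$, $\pi^{ -1}(\sigma(t+1)):=n+1$. For $k=0,\dots,t$, $J_k=(j_{k,1},j_{k,2},\dots)$ is the sequence of all $j\in[n]\setminus I$ with $\pi^{ -1}(\sigma(k))<\pi^{ -1}(j)<\pi^{ -1}(\sigma(k+1))$, listed in increasing order of $\pi^{ -1}(j)$. For $k\in[t-1]$, $Z_k$ is the event that $\textsc{DepRound}$ co-rounds $X_{\sigma(k)}$ and $X_{\sigma(k+1)}$.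
   Formalization: The input probabilities $P=(p_1,\dots,p_n)$ and the weights $a_i$ take rational values. -}

module Defs where

open import Data.Bool using (Bool; true; false; if_then_else_; _∧_)
open import Data.Nat as ℕ using (ℕ; zero; suc)
open import Data.Fin using (Fin; toℕ)
open import Data.Fin.Subset using (Subset; _∈_; ∣_∣)
open import Data.Fin.Subset.Properties using (_∈?_)
open import Data.Fin.Permutation using (Permutation′; _⟨$⟩ʳ_; _⟨$⟩ˡ_)
open import Data.List using (List; []; _∷_; map; filter; allFin; foldr)
open import Data.Maybe using (Maybe; just; nothing)
open import Data.Product using (_×_; _,_)
open import Data.Rational
  using (ℚ; 0ℚ; 1ℚ; _+_; _*_; _-_; _÷_; _⊓_; _⊔_; _≤_; _<_; ≢-nonZero)
open import Data.Rational.Properties using (_≟_; _≤?_; _<?_)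
open import Relation.Nullary using (yes; no; does; ¬_)
open import Relation.Nullary.Decidable using (_×-dec_)

-- Division in ℚ, totalised by x / 0 := 0.  In DepRound under the
-- hypotheses of the lemma (all weights > 0, fractional entries in (0,1))
-- every denominator used is strictly positive, so the totalisation is
-- never exercised.
_/′_ : ℚ → ℚ → ℚ
p /′ q with q ≟ 0ℚ
... | yes _  = 0ℚ
... | no q≢0 = _÷_ p q {{≢-nonZero q≢0}}

infixl 7 _/′_

_≤ᵇ_ : ℚ → ℚ → Bool
p ≤ᵇ q = does (p ≤? q)

_<ᵇ_ : ℚ → ℚ → Bool
p <ᵇ q = does (p <? q)

-- Simplify(a₁,a₂,β₁,β₂) as a finite distribution:
-- a list of (probability , γ₁ , γ₂) outcomes.

γ₂-if-γ₁=0 γ₂-if-γ₁=1 γ₁-if-γ₂=0 γ₁-if-γ₂=1 : ℚ → ℚ → ℚ → ℚ → ℚ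
γ₂-if-γ₁=0 a₁ a₂ β₁ β₂ = β₂ + β₁ * a₁ /′ a₂
γ₂-if-γ₁=1 a₁ a₂ β₁ β₂ = β₂ - (1ℚ - β₁) * a₁ /′ a₂
γ₁-if-γ₂=0 a₁ a₂ β₁ β₂ = β₁ + β₂ * a₂ /′ a₁
γ₁-if-γ₂=1 a₁ a₂ β₁ β₂ = β₁ - (1ℚ - β₂) * a₂ /′ a₁

Simplify : ℚ → ℚ → ℚ → ℚ → List (ℚ × ℚ × ℚ)
Simplify a₁ a₂ β₁ β₂ =
  if s ≤ᵇ (a₁ ⊓ a₂) then caseI
  else if (a₁ <ᵇ s) ∧ (s <ᵇ a₂) then caseII
  else if (a₂ <ᵇ s) ∧ (s <ᵇ a₁) then caseIII
  else if ((a₁ ⊔ a₂) ≤ᵇ s) ∧ (s ≤ᵇ (a₁ + a₂)) then caseIV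
  else []
  where
  s = a₁ * β₁ + a₂ * β₂
  set1-0 set1-1 set2-0 set2-1 : ℚ × ℚ
  set1-0 = 0ℚ , γ₂-if-γ₁=0 a₁ a₂ β₁ β₂
  set1-1 = 1ℚ , γ₂-if-γ₁=1 a₁ a₂ β₁ β₂
  set2-0 = γ₁-if-γ₂=0 a₁ a₂ β₁ β₂ , 0ℚ
  set2-1 = γ₁-if-γ₂=1 a₁ a₂ β₁ β₂ , 1ℚ
  qI  = a₂ * β₂ /′ s
  qIV = a₂ * (1ℚ - β₂) /′ (a₁ * (1ℚ - β₁) + a₂ * (1ℚ - β₂))
  caseI caseII caseIII caseIV : List (ℚ × ℚ × ℚ)
  caseI   = (qI , set1-0) ∷ (1ℚ - qI , set2-0) ∷ []
  caseII  = (β₁ , set1-1) ∷ (1ℚ - β₁ , set1-0) ∷ []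
  caseIII = (β₂ , set2-1) ∷ (1ℚ - β₂ , set2-0) ∷ []
  caseIV  = (qIV , set1-1) ∷ (1ℚ - qIV , set2-1) ∷ []

-- DepRound with a fixed permutation π (π maps positions to indices,
-- so π⁻¹(i) = π ⟨$⟩ˡ i is the position of index i).

module _ {n : ℕ} (A : Fin n → ℚ) (π : Permutation′ n) where

  πOrder : List (Fin n)
  πOrder = map (π ⟨$⟩ʳ_) (allFin n)

  position : Fin n → ℕ
  position i = toℕ (π ⟨$⟩ˡ i)

  isFrac : (Fin n → ℚ) → Fin n → Bool
  isFrac X i = (0ℚ <ᵇ X i) ∧ (X i <ᵇ 1ℚ)

  fracInOrder : (Fin n → ℚ) → List (Fin n)
  fracInOrder X = filter (λ i → (0ℚ <? X i) ×-dec (X i <? 1ℚ)) πOrder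

  firstTwo : (Fin n → ℚ) → Maybe (Fin n × Fin n)
  firstTwo X with fracInOrder X
  ... | i ∷ j ∷ _ = just (i , j)
  ... | _         = nothing

  update2 : (Fin n → ℚ) → Fin n → Fin n → ℚ → ℚ → (Fin n → ℚ)
  update2 X i j x y k with does (Data.Fin._≟_ k i) | does (Data.Fin._≟_ k j)
  ... | true  | _     = x
  ... | false | true  = y
  ... | false | false = X k

  changed : (Fin n → ℚ) → (Fin n → ℚ) → Fin n → Bool
  changed X Y k = if does (X k ≟ Y k) then false else true

  -- probability (over the coins of Simplify) that, starting from state X
  -- and running at most `fuel` further steps, some step changes both
  -- X_u and X_v (i.e. u and v are co-rounded).
  -- Each step makes at least one fractional entry integral, so fuel n
  -- suffices for the whole run of DepRound.
  prCoRound : (u v : Fin n) → ℕ → (Fin n → ℚ) → ℚ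
  prCoRound u v zero X = 0ℚ
  prCoRound u v (suc fuel) X with firstTwo X
  ... | nothing      = 0ℚ
  ... | just (i , j) =
        foldr (λ { (q , g₁ , g₂) acc → q * contrib (update2 X i j g₁ g₂) + acc })
              0ℚ (Simplify (A i) (A j) (X i) (X j))
    where
    contrib : (Fin n → ℚ) → ℚ
    contrib Y = if changed X Y u ∧ changed X Y v then 1ℚ
                else prCoRound u v fuel Y

  PrCoRounded : (P : Fin n → ℚ) → (u v : Fin n) → ℚ
  PrCoRounded P u v = prCoRound u v n P

lookupℕ : {B : Set} → List B → ℕ → Maybe B
lookupℕ []       _       = nothing
lookupℕ (x ∷ xs) zero    = just x
lookupℕ (x ∷ xs) (suc k) = lookupℕ xs k

module _ {n : ℕ} (π : Permutation′ n) (I : Subset n) where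

  IinOrder : List (Fin n)
  IinOrder = filter (λ j → j ∈? I) (map (π ⟨$⟩ʳ_) (allFin n))

  -- σ(k) for k ∈ [t] (1-indexed); nothing outside that range
  σ : ℕ → Maybe (Fin n)
  σ zero    = nothing
  σ (suc k) = lookupℕ IinOrder k

  Jbetween : Fin n → Fin n → List (Fin n)
  Jbetween u v =
    filter (λ j → (toℕ (π ⟨$⟩ˡ u) ℕ.<? toℕ (π ⟨$⟩ˡ j))
                  ×-dec (toℕ (π ⟨$⟩ˡ j) ℕ.<? toℕ (π ⟨$⟩ˡ v))
                  ×-dec Relation.Nullary.¬? (j ∈? I))
           (map (π ⟨$⟩ʳ_) (allFin n))

α : {n : ℕ} → (Fin n → ℚ) → Fin n → ℚ
α P i = P i ⊓ (1ℚ - P i)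

pairProduct : {n : ℕ} → (Fin n → ℚ) → List (Fin n) → ℚ
pairProduct P (x ∷ y ∷ rest) = (1ℚ - α P x * α P y) * pairProduct P rest
pairProduct P _              = 1ℚ

-- Pr[Z_k | π] and δ_k  (defaults 0 / 1 only for k outside [t-1])

PrZ : {n : ℕ} (P A : Fin n → ℚ) (I : Subset n) (π : Permutation′ n) → ℕ → ℚ
PrZ P A I π k with σ π I k | σ π I (suc k)
... | just u | just v = PrCoRounded A π P u v
... | _      | _      = 0ℚ

δ : {n : ℕ} (P : Fin n → ℚ) (I : Subset n) (π : Permutation′ n) → ℕ → ℚ
δ P I π k with σ π I k | σ π I (suc k)
... | just u | just v = pairProduct P (Jbetween π I u v)
... | _      | _      = 1ℚ

-- Once no entry before u = σ(k) is fractional, u is the earliest fractional entry, so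
-- DepRound co-rounds it with the fractional entries of J_k one after another until u
-- becomes integral (and is never co-rounded with v = σ(k+1)) or J_k is used up.
-- Against a consecutive pair (j_{2i-1}, j_{2i}) of J_k, u stays fractional with
-- probability at most 1 - α α: in one step u survives with probability at most 1 - α
-- of its partner unless Simplify is in case III, and when the first step is in case III
-- its two outcomes shift the load of the second step by a_{j_{2i-1}}, which under
-- a_max ≤ 2 a_min keeps the second step out of case III in at least one branch.
-- Hence a potential built from these factors is a supermartingale bounded by δ_k.
-- Steps before u leave v and J_k untouched and never co-round u with v.

module Submission where

module CoRounding where

  open import Defs
  open import Data.Nat using (ℕ; zero; suc)
  import Data.Nat as ℕ
  import Data.Nat.Properties as ℕ
  open import Data.Fin using (Fin; toℕ)
  import Data.Fin as Fin
  open import Data.Fin.Permutation using (Permutation′; _⟨$⟩ʳ_; _⟨$⟩ˡ_; inverseˡ)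
  open import Data.Fin.Subset using () renaming (_∈_ to _∈ₛ_)
  open import Data.Fin.Subset.Properties using (_∈?_)
  open import Data.Maybe using (just; nothing)
  open import Data.Bool using (true; false; if_then_else_; _∧_; T)
  open import Data.Bool.Properties using (T-∧; ∧-zeroʳ)
  open import Data.Empty using (⊥; ⊥-elim)
  open import Data.List using (List; []; _∷_; _++_; foldr; filter; map; allFin)
  open import Data.List.Membership.Propositional using (_∈_)
  open import Data.List.Membership.Propositional.Properties using (∈-filter⁻; ∈-++⁺ʳ)
  open import Data.List.Relation.Unary.Any using (here; there)
  open import Data.List.Relation.Unary.All using (All; []; _∷_)
  import Data.List.Relation.Unary.All as All
  open import Data.List.Relation.Unary.All.Properties using (++⁻ˡ; ++⁻ʳ; map⁺)
  open import Data.List.Relation.Unary.AllPairs using (AllPairs; []; _∷_)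
  import Data.List.Relation.Unary.AllPairs as AllPairs
  import Data.List.Relation.Unary.AllPairs.Properties as AllPairsₚ
  open import Data.Product using (_×_; _,_; proj₁; proj₂; Σ-syntax)
  open import Data.Rational
    using (ℚ; 0ℚ; 1ℚ; _+_; _*_; _-_; -_; _⊓_; _⊔_; _≤_; _<_; ≢-nonZero; positive; nonNegative)
  open import Data.Rational.Properties
  open import Data.Rational.Solver using (module +-*-Solver)
  open import Data.Sum using (_⊎_; inj₁; inj₂)
  open import Data.List.Properties
    using (filter-++; filter-accept; filter-reject; filter-none; filter-all; ++-identityʳ; map-++; map-cong-local)
  open import Function using (_∘_)
  open import Function.Bundles using (Equivalence)
  open import Relation.Binary.PropositionalEquality
  open import Relation.Nullary using (Dec; yes; no; does; ¬_; ¬?)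
  open import Relation.Nullary.Decidable using (_×-dec_; dec-true)

  open +-*-Solver

  p≤q⇒0≤q-p : ∀ {p q} → p ≤ q → 0ℚ ≤ q - p
  p≤q⇒0≤q-p {p} {q} h = subst (_≤ q - p) (+-inverseʳ p) (+-monoˡ-≤ (- p) h)

  0≤q-p⇒p≤q : ∀ {p q} → 0ℚ ≤ q - p → p ≤ q
  0≤q-p⇒p≤q {p} {q} h =
    subst₂ _≤_ (+-identityˡ p) (solve 2 (λ p q → (q :- p) :+ p := q) refl p q) (+-monoˡ-≤ p h)

  p<q⇒0<q-p : ∀ {p q} → p < q → 0ℚ < q - p
  p<q⇒0<q-p {p} {q} h = subst (_< q - p) (+-inverseʳ p) (+-monoˡ-< (- p) h)

  +-nonNeg : ∀ {p q} → 0ℚ ≤ p → 0ℚ ≤ q → 0ℚ ≤ p + q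
  +-nonNeg {p} {q} h₁ h₂ = subst (_≤ p + q) (+-identityʳ 0ℚ) (+-mono-≤ h₁ h₂)

  +-pos-nonNeg : ∀ {p q} → 0ℚ < p → 0ℚ ≤ q → 0ℚ < p + q
  +-pos-nonNeg {p} {q} h₁ h₂ = subst (_< p + q) (+-identityʳ 0ℚ) (+-mono-<-≤ h₁ h₂)

  *-nonNeg : ∀ {p q} → 0ℚ ≤ p → 0ℚ ≤ q → 0ℚ ≤ p * q
  *-nonNeg {p} {q} h₁ h₂ =
    nonNegative⁻¹ _ {{nonNeg*nonNeg⇒nonNeg p {{nonNegative h₁}} q {{nonNegative h₂}}}}

  *-pos : ∀ {p q} → 0ℚ < p → 0ℚ < q → 0ℚ < p * q
  *-pos {p} {q} h₁ h₂ = positive⁻¹ _ {{pos*pos⇒pos p {{positive h₁}} q {{positive h₂}}}}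

  *-monoˡ-≤ : ∀ {r p q} → 0ℚ ≤ r → p ≤ q → r * p ≤ r * q
  *-monoˡ-≤ {r} h = *-monoˡ-≤-nonNeg r {{nonNegative h}}

  *-monoʳ-≤ : ∀ {r p q} → 0ℚ ≤ r → p ≤ q → p * r ≤ q * r
  *-monoʳ-≤ {r} h = *-monoʳ-≤-nonNeg r {{nonNegative h}}

  1-‿antimono-≤ : ∀ {p q} → p ≤ q → 1ℚ - q ≤ 1ℚ - p
  1-‿antimono-≤ h = +-monoʳ-≤ 1ℚ (neg-antimono-≤ h)

  q≤p+q : ∀ {p q} → 0ℚ ≤ p → q ≤ p + q
  q≤p+q {p} {q} h = subst (_≤ p + q) (+-identityˡ q) (+-monoˡ-≤ q h)

  0≤1 : 0ℚ ≤ 1ℚ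
  0≤1 = <⇒≤ (positive⁻¹ 1ℚ)

  /′-*-cancel : ∀ p {q} → 0ℚ < q → (p /′ q) * q ≡ p
  /′-*-cancel p {q} h with q ≟ 0ℚ
  ... | yes q≡0 = ⊥-elim (<-irrefl (sym q≡0) h)
  ... | no q≢0  =
    trans (*-assoc p _ q) (trans (cong (p *_) (*-inverseˡ q {{≢-nonZero q≢0}})) (*-identityʳ p))

  p≤r*q⇒p/′q≤r : ∀ {p q r} → 0ℚ < q → p ≤ r * q → p /′ q ≤ r
  p≤r*q⇒p/′q≤r {p} {q} h le =
    *-cancelʳ-≤-pos q {{positive h}} (subst (_≤ _) (sym (/′-*-cancel p h)) le)

  r*q≤p⇒r≤p/′q : ∀ {p q r} → 0ℚ < q → r * q ≤ p → r ≤ p /′ q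
  r*q≤p⇒r≤p/′q {p} {q} h le =
    *-cancelʳ-≤-pos q {{positive h}} (subst (_ ≤_) (sym (/′-*-cancel p h)) le)

  /′-nonNeg : ∀ {p q} → 0ℚ ≤ p → 0ℚ < q → 0ℚ ≤ p /′ q
  /′-nonNeg {p} {q} hp h = r*q≤p⇒r≤p/′q h (subst (_≤ p) (sym (*-zeroˡ q)) hp)

  module _ {A : Set} {P : A → Set} (P? : ∀ x → Dec (P x)) where

    filter-≡[]⁻ : ∀ xs → filter P? xs ≡ [] → All (¬_ ∘ P) xs
    filter-≡[]⁻ []       _  = []
    filter-≡[]⁻ (x ∷ xs) eq with P? x
    ... | no ¬px = ¬px ∷ filter-≡[]⁻ xs eq

    filter-≡∷⁻ : ∀ xs {y ys} → filter P? xs ≡ y ∷ ys →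
      Σ[ zs ∈ List A ] Σ[ rest ∈ List A ] xs ≡ zs ++ y ∷ rest × All (¬_ ∘ P) zs × P y
    filter-≡∷⁻ (x ∷ xs) eq with P? x
    filter-≡∷⁻ (x ∷ xs) refl | yes px = [] , xs , refl , [] , px
    ... | no ¬px with filter-≡∷⁻ xs eq
    ...   | zs , rest , xs≡ , zs∉ , py = x ∷ zs , rest , cong (x ∷_) xs≡ , ¬px ∷ zs∉ , py

    lookupℕ-filter-consecutive : ∀ xs k {x y} →
      lookupℕ (filter P? xs) k ≡ just x → lookupℕ (filter P? xs) (suc k) ≡ just y →
      Σ[ pre ∈ List A ] Σ[ mid ∈ List A ] Σ[ post ∈ List A ] xs ≡ pre ++ x ∷ mid ++ y ∷ post × All (¬_ ∘ P) mid
    lookupℕ-filter-consecutive (z ∷ xs) k lx ly with P? z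
    lookupℕ-filter-consecutive (z ∷ xs) zero refl ly | yes _ with filter P? xs in fracs
    ... | y ∷ _ with refl ← ly with mid , post , xs≡ , mid∉ , _ ← filter-≡∷⁻ xs fracs =
      [] , mid , post , cong (z ∷_) xs≡ , mid∉
    lookupℕ-filter-consecutive (z ∷ xs) (suc k) lx ly | yes _
      with pre , mid , post , xs≡ , mid∉ ← lookupℕ-filter-consecutive xs k lx ly =
      z ∷ pre , mid , post , cong (z ∷_) xs≡ , mid∉
    lookupℕ-filter-consecutive (z ∷ xs) k lx ly | no _
      with pre , mid , post , xs≡ , mid∉ ← lookupℕ-filter-consecutive xs k lx ly =
      z ∷ pre , mid , post , cong (z ∷_) xs≡ , mid∉

  AllPairs-++⁻ : ∀ {A : Set} {R : A → A → Set} xs {ys} → AllPairs R (xs ++ ys) →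
    AllPairs R xs × AllPairs R ys × All (λ x → All (R x) ys) xs
  AllPairs-++⁻ []       rs         = [] , rs , []
  AllPairs-++⁻ (x ∷ xs) (rx ∷ rxs) with AllPairs-++⁻ xs rxs
  ... | rxs₁ , rys , rxys = ++⁻ˡ xs rx ∷ rxs₁ , rys , ++⁻ʳ xs rx ∷ rxys

  Fractional : ℚ → Set
  Fractional x = 0ℚ < x × x < 1ℚ

  fractional? : ∀ x → Dec (Fractional x)
  fractional? x = (0ℚ <? x) ×-dec (x <? 1ℚ)

  ¬fractional-0 : ¬ Fractional 0ℚ
  ¬fractional-0 (0<0 , _) = <-irrefl refl 0<0

  ¬fractional-1 : ¬ Fractional 1ℚ
  ¬fractional-1 (_ , 1<1) = <-irrefl refl 1<1

  Outcome : Set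
  Outcome = ℚ × ℚ × ℚ

  module _ (a b x y : ℚ) where

    load qI qIV : ℚ
    load = a * x + b * y
    qI   = b * y /′ load
    qIV  = b * (1ℚ - y) /′ (a * (1ℚ - x) + b * (1ℚ - y))

    outcomesI outcomesII outcomesIII outcomesIV : List Outcome
    outcomesI   = (qI , 0ℚ , γ₂-if-γ₁=0 a b x y) ∷ (1ℚ - qI , γ₁-if-γ₂=0 a b x y , 0ℚ) ∷ []
    outcomesII  = (x , 1ℚ , γ₂-if-γ₁=1 a b x y) ∷ (1ℚ - x , 0ℚ , γ₂-if-γ₁=0 a b x y) ∷ []
    outcomesIII = (y , γ₁-if-γ₂=1 a b x y , 1ℚ) ∷ (1ℚ - y , γ₁-if-γ₂=0 a b x y , 0ℚ) ∷ []
    outcomesIV  = (qIV , 1ℚ , γ₂-if-γ₁=1 a b x y) ∷ (1ℚ - qIV , γ₁-if-γ₂=1 a b x y , 1ℚ) ∷ []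

    data SimplifyCase : List Outcome → Set where
      caseI   : load ≤ a ⊓ b → SimplifyCase outcomesI
      caseII  : SimplifyCase outcomesII
      caseIII : b < load → load < a → SimplifyCase outcomesIII
      caseIV  : a ⊔ b ≤ load → SimplifyCase outcomesIV
      noCase  : SimplifyCase []

    simplifyCase : SimplifyCase (Simplify a b x y)
    simplifyCase =
      byTests (load ≤ᵇ (a ⊓ b)) ((a <ᵇ load) ∧ (load <ᵇ b)) ((b <ᵇ load) ∧ (load <ᵇ a))
              (((a ⊔ b) ≤ᵇ load) ∧ (load ≤ᵇ (a + b)))
              (witness (load ≤? (a ⊓ b)))
              (λ t → let t₁ , t₂ = Equivalence.to T-∧ t
                     in witness (b <? load) t₁ , witness (load <? a) t₂)
              (witness ((a ⊔ b) ≤? load) ∘ proj₁ ∘ Equivalence.to T-∧)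
      where
      witness : ∀ {A : Set} (d : Dec A) → T (does d) → A
      witness (yes a) _ = a
      byTests : ∀ c₁ c₂ c₃ c₄ → (T c₁ → load ≤ a ⊓ b) → (T c₃ → b < load × load < a) →
                (T c₄ → a ⊔ b ≤ load) →
                SimplifyCase (if c₁ then outcomesI else if c₂ then outcomesII
                              else if c₃ then outcomesIII else if c₄ then outcomesIV else [])
      byTests true  _     _     _     h₁ _  _  = caseI (h₁ _)
      byTests false true  _     _     _  _  _  = caseII
      byTests false false true  _     _  h₃ _  = caseIII (proj₁ (h₃ _)) (proj₂ (h₃ _))
      byTests false false false true  _  _  h₄ = caseIV (h₄ _)
      byTests false false false false _  _  _  = noCase

  𝔼 : List Outcome → (ℚ → ℚ → ℚ) → ℚ
  𝔼 []                     F = 0ℚ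
  𝔼 ((q , γ₁ , γ₂) ∷ os) F = q * F γ₁ γ₂ + 𝔼 os F

  IsSubDistribution : List Outcome → Set
  IsSubDistribution os = All (λ o → 0ℚ ≤ proj₁ o) os × 𝔼 os (λ _ _ → 1ℚ) ≤ 1ℚ

  𝔼-pair : ∀ q₁ x₁ y₁ q₂ x₂ y₂ (F : ℚ → ℚ → ℚ) →
    𝔼 ((q₁ , x₁ , y₁) ∷ (q₂ , x₂ , y₂) ∷ []) F ≡ q₁ * F x₁ y₁ + q₂ * F x₂ y₂
  𝔼-pair q₁ x₁ y₁ q₂ x₂ y₂ F = cong (q₁ * F x₁ y₁ +_) (+-identityʳ _)

  𝔼-cong : ∀ os {F G} → (∀ γ₁ γ₂ → F γ₁ γ₂ ≡ G γ₁ γ₂) → 𝔼 os F ≡ 𝔼 os G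
  𝔼-cong []                    eq = refl
  𝔼-cong ((q , γ₁ , γ₂) ∷ os) eq = cong₂ (λ f e → q * f + e) (eq γ₁ γ₂) (𝔼-cong os eq)

  𝔼-mono : ∀ {os F G} → All (λ o → 0ℚ ≤ proj₁ o) os →
    All (λ (_ , γ₁ , γ₂) → F γ₁ γ₂ ≤ G γ₁ γ₂) os → 𝔼 os F ≤ 𝔼 os G
  𝔼-mono []         []         = ≤-refl
  𝔼-mono (q≥0 ∷ qs) (le ∷ les) = +-mono-≤ (*-monoˡ-≤ q≥0 le) (𝔼-mono qs les)

  𝔼-nonNeg : ∀ {os F} → All (λ o → 0ℚ ≤ proj₁ o) os → (∀ γ₁ γ₂ → 0ℚ ≤ F γ₁ γ₂) → 0ℚ ≤ 𝔼 os F
  𝔼-nonNeg []         h = ≤-refl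
  𝔼-nonNeg (q≥0 ∷ qs) h = +-nonNeg (*-nonNeg q≥0 (h _ _)) (𝔼-nonNeg qs h)

  𝔼-*ʳ : ∀ os F K → 𝔼 os (λ γ₁ γ₂ → F γ₁ γ₂ * K) ≡ 𝔼 os F * K
  𝔼-*ʳ []                    F K = sym (*-zeroˡ K)
  𝔼-*ʳ ((q , γ₁ , γ₂) ∷ os) F K =
    trans (cong (q * (F γ₁ γ₂ * K) +_) (𝔼-*ʳ os F K))
          (solve 4 (λ q f k e → q :* (f :* k) :+ e :* k := (q :* f :+ e) :* k) refl q (F γ₁ γ₂) K (𝔼 os F))

  𝔼-≤ : ∀ {os F K} → IsSubDistribution os → 0ℚ ≤ K → (∀ γ₁ γ₂ → F γ₁ γ₂ ≤ K) → 𝔼 os F ≤ K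
  𝔼-≤ {os} {F} {K} (qs , total≤1) K≥0 le = begin
    𝔼 os F                          ≤⟨ 𝔼-mono qs (All.universal (λ (_ , γ₁ , γ₂) → le γ₁ γ₂) os) ⟩
    𝔼 os (λ _ _ → K)                ≡⟨ 𝔼-cong os (λ _ _ → sym (*-identityˡ K)) ⟩
    𝔼 os (λ _ _ → 1ℚ * K)           ≡⟨ 𝔼-*ʳ os (λ _ _ → 1ℚ) K ⟩
    𝔼 os (λ _ _ → 1ℚ) * K           ≤⟨ *-monoʳ-≤ K≥0 total≤1 ⟩
    1ℚ * K                          ≡⟨ *-identityˡ K ⟩
    K                               ∎
    where open ≤-Reasoning

  coin-isSubDistribution : ∀ q x₁ y₁ x₂ y₂ → 0ℚ ≤ q → q ≤ 1ℚ →
    IsSubDistribution ((q , x₁ , y₁) ∷ (1ℚ - q , x₂ , y₂) ∷ [])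
  coin-isSubDistribution q _ _ _ _ q≥0 q≤1 =
    q≥0 ∷ p≤q⇒0≤q-p q≤1 ∷ [] ,
    ≤-reflexive (solve 1 (λ q → q :* con 1ℚ :+ ((con 1ℚ :- q) :* con 1ℚ :+ con 0ℚ) := con 1ℚ) refl q)

  module _ {a b x y : ℚ} (a>0 : 0ℚ < a) (b>0 : 0ℚ < b) (x∈ : Fractional x) (y∈ : Fractional y) where

    load>0 : 0ℚ < load a b x y
    load>0 = +-pos-nonNeg (*-pos a>0 (proj₁ x∈)) (<⇒≤ (*-pos b>0 (proj₁ y∈)))

    slack>0 : 0ℚ < a * (1ℚ - x) + b * (1ℚ - y)
    slack>0 = +-pos-nonNeg (*-pos a>0 (p<q⇒0<q-p (proj₂ x∈))) (<⇒≤ (*-pos b>0 (p<q⇒0<q-p (proj₂ y∈))))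

    qI-nonNeg : 0ℚ ≤ qI a b x y
    qI-nonNeg = /′-nonNeg (<⇒≤ (*-pos b>0 (proj₁ y∈))) load>0

    qI≤1 : qI a b x y ≤ 1ℚ
    qI≤1 = p≤r*q⇒p/′q≤r load>0
      (subst (b * y ≤_) (sym (*-identityˡ _)) (q≤p+q (<⇒≤ (*-pos a>0 (proj₁ x∈)))))

    qIV-nonNeg : 0ℚ ≤ qIV a b x y
    qIV-nonNeg = /′-nonNeg (<⇒≤ (*-pos b>0 (p<q⇒0<q-p (proj₂ y∈)))) slack>0

    qIV≤1 : qIV a b x y ≤ 1ℚ
    qIV≤1 = p≤r*q⇒p/′q≤r slack>0
      (subst (b * (1ℚ - y) ≤_) (sym (*-identityˡ _)) (q≤p+q (<⇒≤ (*-pos a>0 (p<q⇒0<q-p (proj₂ x∈))))))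

    Simplify-isSubDistribution : IsSubDistribution (Simplify a b x y)
    Simplify-isSubDistribution = byCase (simplifyCase a b x y)
      where
      byCase : ∀ {os} → SimplifyCase a b x y os → IsSubDistribution os
      byCase (caseI _)     = coin-isSubDistribution _ _ _ _ _ qI-nonNeg qI≤1
      byCase caseII        = coin-isSubDistribution _ _ _ _ _ (<⇒≤ (proj₁ x∈)) (<⇒≤ (proj₂ x∈))
      byCase (caseIII _ _) = coin-isSubDistribution _ _ _ _ _ (<⇒≤ (proj₁ y∈)) (<⇒≤ (proj₂ y∈))
      byCase (caseIV _)    = coin-isSubDistribution _ _ _ _ _ qIV-nonNeg qIV≤1
      byCase noCase        = [] , 0≤1

    y≤qI : load a b x y ≤ b → y ≤ qI a b x y
    y≤qI load≤b = r*q≤p⇒r≤p/′q load>0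
      (subst (y * load a b x y ≤_) (*-comm y b) (*-monoˡ-≤ (<⇒≤ (proj₁ y∈)) load≤b))

    1-y≤qIV : a ≤ load a b x y → 1ℚ - y ≤ qIV a b x y
    1-y≤qIV a≤load = r*q≤p⇒r≤p/′q slack>0
      (subst ((1ℚ - y) * (a * (1ℚ - x) + b * (1ℚ - y)) ≤_) (*-comm (1ℚ - y) b)
             (*-monoˡ-≤ (<⇒≤ (p<q⇒0<q-p (proj₂ y∈))) slack≤b))
      where
      slack≤b : a * (1ℚ - x) + b * (1ℚ - y) ≤ b
      slack≤b = 0≤q-p⇒p≤q (subst (0ℚ ≤_)
        (solve 4 (λ a b x y → (a :* x :+ b :* y) :- a := b :- (a :* (con 1ℚ :- x) :+ b :* (con 1ℚ :- y)))
               refl a b x y)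
        (p≤q⇒0≤q-p a≤load))

  Simplify-roundsOne : ∀ a b x y →
    All (λ (_ , γ₁ , γ₂) → Fractional γ₁ → ¬ Fractional γ₂) (Simplify a b x y)
  Simplify-roundsOne a b x y = byCase (simplifyCase a b x y)
    where
    byCase : ∀ {os} → SimplifyCase a b x y os → All (λ (_ , γ₁ , γ₂) → Fractional γ₁ → ¬ Fractional γ₂) os
    byCase (caseI _)     = (⊥-elim ∘ ¬fractional-0) ∷ (λ _ → ¬fractional-0) ∷ []
    byCase caseII        = (⊥-elim ∘ ¬fractional-1) ∷ (⊥-elim ∘ ¬fractional-0) ∷ []
    byCase (caseIII _ _) = (λ _ → ¬fractional-1) ∷ (λ _ → ¬fractional-0) ∷ []
    byCase (caseIV _)    = (⊥-elim ∘ ¬fractional-1) ∷ (λ _ → ¬fractional-1) ∷ []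
    byCase noCase        = []

  -- α clipped at 0: it agrees with α on [0,1] and vanishes off (0,1), so the
  -- bounds below need no invariant keeping the entries of X inside [0,1].
  α⁺ : ℚ → ℚ
  α⁺ x = (x ⊓ (1ℚ - x)) ⊔ 0ℚ

  α⁺-nonNeg : ∀ x → 0ℚ ≤ α⁺ x
  α⁺-nonNeg x = p≤q⊔p (x ⊓ (1ℚ - x)) 0ℚ

  α⁺-fractional : ∀ {x} → Fractional x → α⁺ x ≡ x ⊓ (1ℚ - x)
  α⁺-fractional (x>0 , x<1) = p≥q⇒p⊔q≡p (⊓-glb (<⇒≤ x>0) (<⇒≤ (p<q⇒0<q-p x<1)))

  α⁺≤x : ∀ {x} → Fractional x → α⁺ x ≤ x
  α⁺≤x {x} x∈ = subst (_≤ x) (sym (α⁺-fractional x∈)) (p⊓q≤p x (1ℚ - x))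

  α⁺≤1-x : ∀ {x} → Fractional x → α⁺ x ≤ 1ℚ - x
  α⁺≤1-x {x} x∈ = subst (_≤ 1ℚ - x) (sym (α⁺-fractional x∈)) (p⊓q≤q x (1ℚ - x))

  α⁺-integral : ∀ {x} → ¬ Fractional x → α⁺ x ≡ 0ℚ
  α⁺-integral {x} x∉ with 0ℚ <? x | x <? 1ℚ
  ... | no x≯0  | _        = p≤q⇒p⊔q≡q (≤-trans (p⊓q≤p x _) (≮⇒≥ x≯0))
  ... | yes x>0 | yes x<1  = ⊥-elim (x∉ (x>0 , x<1))
  ... | yes _   | no x≮1   = p≤q⇒p⊔q≡q (≤-trans (p⊓q≤q x _) (0≤q-p⇒p≤q (subst (0ℚ ≤_)
    (solve 1 (λ x → x :- con 1ℚ := con 0ℚ :- (con 1ℚ :- x)) refl x) (p≤q⇒0≤q-p (≮⇒≥ x≮1)))))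

  α⁺≤1 : ∀ x → α⁺ x ≤ 1ℚ
  α⁺≤1 x with fractional? x
  ... | yes x∈ = ≤-trans (α⁺≤x x∈) (<⇒≤ (proj₂ x∈))
  ... | no x∉  = subst (_≤ 1ℚ) (sym (α⁺-integral x∉)) 0≤1

  α⁺*α⁺≤α⁺ : ∀ x y → α⁺ x * α⁺ y ≤ α⁺ x
  α⁺*α⁺≤α⁺ x y = subst (α⁺ x * α⁺ y ≤_) (*-identityʳ (α⁺ x)) (*-monoˡ-≤ (α⁺-nonNeg x) (α⁺≤1 y))

  1-α⁺*α⁺-nonNeg : ∀ x y → 0ℚ ≤ 1ℚ - α⁺ x * α⁺ y
  1-α⁺*α⁺-nonNeg x y = p≤q⇒0≤q-p (≤-trans (α⁺*α⁺≤α⁺ x y) (α⁺≤1 x))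

  ifFractional : ℚ → ℚ → ℚ
  ifFractional y v with fractional? y
  ... | yes _ = v
  ... | no _  = 0ℚ

  ifFractional-no : ∀ {y} v → ¬ Fractional y → ifFractional y v ≡ 0ℚ
  ifFractional-no {y} v y∉ with fractional? y
  ... | yes y∈ = ⊥-elim (y∉ y∈)
  ... | no _   = refl

  ifFractional-≤ : ∀ y {v K} → 0ℚ ≤ K → (Fractional y → v ≤ K) → ifFractional y v ≤ K
  ifFractional-≤ y K≥0 le with fractional? y
  ... | yes y∈ = le y∈
  ... | no _   = K≥0

  ifFractional-nonNeg : ∀ y {v} → (Fractional y → 0ℚ ≤ v) → 0ℚ ≤ ifFractional y v
  ifFractional-nonNeg y h with fractional? y
  ... | yes y∈ = h y∈
  ... | no _   = ≤-refl

  𝔼-firstIntegral : ∀ q x₁ y₁ x₂ y₂ (F : ℚ → ℚ → ℚ) → ¬ Fractional x₁ → q ≤ 1ℚ → (Fractional x₂ → F x₂ y₂ ≤ 1ℚ) →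
    𝔼 ((q , x₁ , y₁) ∷ (1ℚ - q , x₂ , y₂) ∷ []) (λ γ₁ γ₂ → ifFractional γ₁ (F γ₁ γ₂)) ≤ 1ℚ - q
  𝔼-firstIntegral q x₁ y₁ x₂ y₂ F x₁∉ q≤1 F≤1 = begin
    𝔼 ((q , x₁ , y₁) ∷ (1ℚ - q , x₂ , y₂) ∷ []) (λ γ₁ γ₂ → ifFractional γ₁ (F γ₁ γ₂))
      ≡⟨ 𝔼-pair q x₁ y₁ (1ℚ - q) x₂ y₂ (λ γ₁ γ₂ → ifFractional γ₁ (F γ₁ γ₂)) ⟩
    q * ifFractional x₁ (F x₁ y₁) + (1ℚ - q) * ifFractional x₂ (F x₂ y₂)
      ≡⟨ cong (λ z → q * z + (1ℚ - q) * ifFractional x₂ (F x₂ y₂)) (ifFractional-no (F x₁ y₁) x₁∉) ⟩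
    q * 0ℚ + (1ℚ - q) * ifFractional x₂ (F x₂ y₂)
      ≤⟨ +-monoʳ-≤ (q * 0ℚ) (*-monoˡ-≤ (p≤q⇒0≤q-p q≤1) (ifFractional-≤ x₂ 0≤1 F≤1)) ⟩
    q * 0ℚ + (1ℚ - q) * 1ℚ
      ≡⟨ solve 1 (λ q → q :* con 0ℚ :+ (con 1ℚ :- q) :* con 1ℚ := con 1ℚ :- q) refl q ⟩
    1ℚ - q ∎
    where open ≤-Reasoning

  𝔼-bothIntegral : ∀ q₁ x₁ y₁ q₂ x₂ y₂ (F : ℚ → ℚ → ℚ) → ¬ Fractional x₁ → ¬ Fractional x₂ →
    𝔼 ((q₁ , x₁ , y₁) ∷ (q₂ , x₂ , y₂) ∷ []) (λ γ₁ γ₂ → ifFractional γ₁ (F γ₁ γ₂)) ≡ 0ℚ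
  𝔼-bothIntegral q₁ x₁ y₁ q₂ x₂ y₂ F x₁∉ x₂∉ = begin
    𝔼 ((q₁ , x₁ , y₁) ∷ (q₂ , x₂ , y₂) ∷ []) (λ γ₁ γ₂ → ifFractional γ₁ (F γ₁ γ₂))
      ≡⟨ 𝔼-pair q₁ x₁ y₁ q₂ x₂ y₂ (λ γ₁ γ₂ → ifFractional γ₁ (F γ₁ γ₂)) ⟩
    q₁ * ifFractional x₁ (F x₁ y₁) + q₂ * ifFractional x₂ (F x₂ y₂)
      ≡⟨ cong₂ (λ z w → q₁ * z + q₂ * w) (ifFractional-no (F x₁ y₁) x₁∉) (ifFractional-no (F x₂ y₂) x₂∉) ⟩
    q₁ * 0ℚ + q₂ * 0ℚ
      ≡⟨ solve 2 (λ q₁ q₂ → q₁ :* con 0ℚ :+ q₂ :* con 0ℚ := con 0ℚ) refl q₁ q₂ ⟩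
    0ℚ ∎
    where open ≡-Reasoning

  module _ (a b x y : ℚ) (F : ℚ → ℚ → ℚ) where

    𝔼-outcomesI≤1-qI : qI a b x y ≤ 1ℚ → (Fractional (γ₁-if-γ₂=0 a b x y) → F (γ₁-if-γ₂=0 a b x y) 0ℚ ≤ 1ℚ) →
      𝔼 (outcomesI a b x y) (λ γ₁ γ₂ → ifFractional γ₁ (F γ₁ γ₂)) ≤ 1ℚ - qI a b x y
    𝔼-outcomesI≤1-qI =
      𝔼-firstIntegral (qI a b x y) 0ℚ (γ₂-if-γ₁=0 a b x y) (γ₁-if-γ₂=0 a b x y) 0ℚ F ¬fractional-0

    𝔼-outcomesII≡0 : 𝔼 (outcomesII a b x y) (λ γ₁ γ₂ → ifFractional γ₁ (F γ₁ γ₂)) ≡ 0ℚ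
    𝔼-outcomesII≡0 = 𝔼-bothIntegral x 1ℚ (γ₂-if-γ₁=1 a b x y) (1ℚ - x) 0ℚ (γ₂-if-γ₁=0 a b x y) F
                                     ¬fractional-1 ¬fractional-0

    𝔼-outcomesIV≤1-qIV : qIV a b x y ≤ 1ℚ → (Fractional (γ₁-if-γ₂=1 a b x y) → F (γ₁-if-γ₂=1 a b x y) 1ℚ ≤ 1ℚ) →
      𝔼 (outcomesIV a b x y) (λ γ₁ γ₂ → ifFractional γ₁ (F γ₁ γ₂)) ≤ 1ℚ - qIV a b x y
    𝔼-outcomesIV≤1-qIV =
      𝔼-firstIntegral (qIV a b x y) 1ℚ (γ₂-if-γ₁=1 a b x y) (γ₁-if-γ₂=1 a b x y) 1ℚ F ¬fractional-1

  survival : (a c y γ : ℚ) → ℚ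
  survival a c y γ = 𝔼 (Simplify a c y γ) (λ γ₁ _ → ifFractional γ₁ 1ℚ)

  module _ {a c y γ : ℚ} (a>0 : 0ℚ < a) (c>0 : 0ℚ < c) (y∈ : Fractional y) (γ∈ : Fractional γ) where

    survival-nonNeg : 0ℚ ≤ survival a c y γ
    survival-nonNeg = 𝔼-nonNeg (proj₁ (Simplify-isSubDistribution a>0 c>0 y∈ γ∈))
                               (λ γ₁ _ → ifFractional-nonNeg γ₁ (λ _ → 0≤1))

    survival≤1 : survival a c y γ ≤ 1ℚ
    survival≤1 = 𝔼-≤ (Simplify-isSubDistribution a>0 c>0 y∈ γ∈) 0≤1
                     (λ γ₁ _ → ifFractional-≤ γ₁ 0≤1 (λ _ → ≤-refl))

    survival≤1-α⁺⊎caseIII : survival a c y γ ≤ 1ℚ - α⁺ γ ⊎ (c < load a c y γ × load a c y γ < a)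
    survival≤1-α⁺⊎caseIII = byCase (simplifyCase a c y γ)
      where
      byCase : ∀ {os} → SimplifyCase a c y γ os →
               𝔼 os (λ γ₁ _ → ifFractional γ₁ 1ℚ) ≤ 1ℚ - α⁺ γ ⊎ (c < load a c y γ × load a c y γ < a)
      byCase (caseI load≤a⊓c) = inj₁ (≤-trans
        (𝔼-outcomesI≤1-qI a c y γ (λ _ _ → 1ℚ) (qI≤1 a>0 c>0 y∈ γ∈) (λ _ → ≤-refl))
        (1-‿antimono-≤ (≤-trans (α⁺≤x γ∈) (y≤qI a>0 c>0 y∈ γ∈ (≤-trans load≤a⊓c (p⊓q≤q a c))))))
      byCase caseII = inj₁ (subst (_≤ 1ℚ - α⁺ γ)
        (sym (𝔼-outcomesII≡0 a c y γ (λ _ _ → 1ℚ))) (p≤q⇒0≤q-p (α⁺≤1 γ)))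
      byCase (caseIII c<load load<a) = inj₂ (c<load , load<a)
      byCase (caseIV a⊔c≤load) = inj₁ (≤-trans
        (𝔼-outcomesIV≤1-qIV a c y γ (λ _ _ → 1ℚ) (qIV≤1 a>0 c>0 y∈ γ∈) (λ _ → ≤-refl))
        (1-‿antimono-≤ (≤-trans (α⁺≤1-x γ∈) (1-y≤qIV a>0 c>0 y∈ γ∈ (≤-trans (p≤p⊔q a c) a⊔c≤load)))))
      byCase noCase = inj₁ (p≤q⇒0≤q-p (α⁺≤1 γ))

  caseIII-gap : ∀ {a} b x β → 0ℚ < a → a * γ₁-if-γ₂=0 a b x β - a * γ₁-if-γ₂=1 a b x β ≡ b
  caseIII-gap {a} b x β a>0 = begin
    a * (x + β * b /′ a) - a * (x - (1ℚ - β) * b /′ a)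
      ≡⟨ solve 4 (λ a x t t' → a :* (x :+ t) :- a :* (x :- t') := t :* a :+ t' :* a) refl a x d₀ d₁ ⟩
    d₀ * a + d₁ * a
      ≡⟨ cong₂ _+_ (/′-*-cancel (β * b) a>0) (/′-*-cancel ((1ℚ - β) * b) a>0) ⟩
    β * b + (1ℚ - β) * b
      ≡⟨ solve 2 (λ β b → β :* b :+ (con 1ℚ :- β) :* b := b) refl β b ⟩
    b ∎
    where
    open ≡-Reasoning
    d₀ d₁ : ℚ
    d₀ = β * b /′ a
    d₁ = (1ℚ - β) * b /′ a

  -- The two branches of case III shift the load of the following step by exactly b,
  -- whereas case III in both branches needs a shift below a - c, and a - c ≤ b
  -- because a ≤ 2b and a ≤ 2c.  This is where the weight ratio bound is used.
  noConsecutiveCaseIII : ∀ {a b c x β γ} → 0ℚ < a → a ≤ (1ℚ + 1ℚ) * b → a ≤ (1ℚ + 1ℚ) * c →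
    c < load a c (γ₁-if-γ₂=1 a b x β) γ → load a c (γ₁-if-γ₂=0 a b x β) γ < a → ⊥
  noConsecutiveCaseIII {a} {b} {c} {x} {β} {γ} a>0 a≤2b a≤2c c<L₁ L₀<a = <-irrefl (sym S≡0) S>0
    where
    L₀ L₁ S : ℚ
    L₀ = load a c (γ₁-if-γ₂=0 a b x β) γ
    L₁ = load a c (γ₁-if-γ₂=1 a b x β) γ
    S  = (((L₁ - c) + (L₁ - c)) + ((a - L₀) + (a - L₀)))
       + (((1ℚ + 1ℚ) * b - a) + ((1ℚ + 1ℚ) * c - a))
    S>0 : 0ℚ < S
    S>0 = +-pos-nonNeg
      (+-pos-nonNeg (+-pos-nonNeg (p<q⇒0<q-p c<L₁) (<⇒≤ (p<q⇒0<q-p c<L₁)))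
                    (+-nonNeg (<⇒≤ (p<q⇒0<q-p L₀<a)) (<⇒≤ (p<q⇒0<q-p L₀<a))))
      (+-nonNeg (p≤q⇒0≤q-p a≤2b) (p≤q⇒0≤q-p a≤2c))
    L₀-L₁≡b : L₀ - L₁ ≡ b
    L₀-L₁≡b = trans
      (solve 5 (λ a c y₀ y₁ γ → (a :* y₀ :+ c :* γ) :- (a :* y₁ :+ c :* γ) := a :* y₀ :- a :* y₁)
             refl a c (γ₁-if-γ₂=0 a b x β) (γ₁-if-γ₂=1 a b x β) γ)
      (caseIII-gap b x β a>0)
    S≡0 : S ≡ 0ℚ
    S≡0 = begin
      S ≡⟨ solve 5 (λ a b c l₀ l₁ →
                (((l₁ :- c) :+ (l₁ :- c)) :+ ((a :- l₀) :+ (a :- l₀)))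
                :+ (((con 1ℚ :+ con 1ℚ) :* b :- a) :+ ((con 1ℚ :+ con 1ℚ) :* c :- a))
                := (con 1ℚ :+ con 1ℚ) :* (b :- (l₀ :- l₁))) refl a b c L₀ L₁ ⟩
      (1ℚ + 1ℚ) * (b - (L₀ - L₁)) ≡⟨ cong (λ d → (1ℚ + 1ℚ) * (b - d)) L₀-L₁≡b ⟩
      (1ℚ + 1ℚ) * (b - b)         ≡⟨ cong ((1ℚ + 1ℚ) *_) (+-inverseʳ b) ⟩
      (1ℚ + 1ℚ) * 0ℚ              ≡⟨ *-zeroʳ (1ℚ + 1ℚ) ⟩
      0ℚ ∎
      where open ≡-Reasoning

  coin≤1-α⁺*α⁺ : ∀ {β γ g₁ g₀} → Fractional β → g₁ ≤ 1ℚ → g₀ ≤ 1ℚ →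
    g₁ ≤ 1ℚ - α⁺ γ ⊎ g₀ ≤ 1ℚ - α⁺ γ → β * g₁ + (1ℚ - β) * g₀ ≤ 1ℚ - α⁺ β * α⁺ γ
  coin≤1-α⁺*α⁺ {β} {γ} {g₁} {g₀} β∈ _ g₀≤1 (inj₁ g₁≤) = begin
    β * g₁ + (1ℚ - β) * g₀              ≤⟨ +-mono-≤ (*-monoˡ-≤ β≥0 g₁≤) (*-monoˡ-≤ 1-β≥0 g₀≤1) ⟩
    β * (1ℚ - α⁺ γ) + (1ℚ - β) * 1ℚ     ≡⟨ solve 2 (λ b g → b :* (con 1ℚ :- g) :+ (con 1ℚ :- b) :* con 1ℚ
                                                          := con 1ℚ :- b :* g) refl β (α⁺ γ) ⟩
    1ℚ - β * α⁺ γ                       ≤⟨ 1-‿antimono-≤ (*-monoʳ-≤ (α⁺-nonNeg γ) (α⁺≤x β∈)) ⟩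
    1ℚ - α⁺ β * α⁺ γ                    ∎
    where
    open ≤-Reasoning
    β≥0 = <⇒≤ (proj₁ β∈)
    1-β≥0 = <⇒≤ (p<q⇒0<q-p (proj₂ β∈))
  coin≤1-α⁺*α⁺ {β} {γ} {g₁} {g₀} β∈ g₁≤1 _ (inj₂ g₀≤) = begin
    β * g₁ + (1ℚ - β) * g₀              ≤⟨ +-mono-≤ (*-monoˡ-≤ β≥0 g₁≤1) (*-monoˡ-≤ 1-β≥0 g₀≤) ⟩
    β * 1ℚ + (1ℚ - β) * (1ℚ - α⁺ γ)     ≡⟨ solve 2 (λ b g → b :* con 1ℚ :+ (con 1ℚ :- b) :* (con 1ℚ :- g)
                                                          := con 1ℚ :- (con 1ℚ :- b) :* g) refl β (α⁺ γ) ⟩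
    1ℚ - (1ℚ - β) * α⁺ γ                ≤⟨ 1-‿antimono-≤ (*-monoʳ-≤ (α⁺-nonNeg γ) (α⁺≤1-x β∈)) ⟩
    1ℚ - α⁺ β * α⁺ γ                    ∎
    where
    open ≤-Reasoning
    β≥0 = <⇒≤ (proj₁ β∈)
    1-β≥0 = <⇒≤ (p<q⇒0<q-p (proj₂ β∈))

  module _ {a c γ : ℚ} (a>0 : 0ℚ < a) (c>0 : 0ℚ < c) (γ∈ : Fractional γ) where

    ifFractional-survival≤1 : ∀ y → ifFractional y (survival a c y γ) ≤ 1ℚ
    ifFractional-survival≤1 y = ifFractional-≤ y 0≤1 (λ y∈ → survival≤1 a>0 c>0 y∈ γ∈)

    ifFractional-survival≤1-α⁺⊎caseIII : ∀ y →
      ifFractional y (survival a c y γ) ≤ 1ℚ - α⁺ γ ⊎ (c < load a c y γ × load a c y γ < a)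
    ifFractional-survival≤1-α⁺⊎caseIII y with fractional? y
    ... | yes y∈ = survival≤1-α⁺⊎caseIII a>0 c>0 y∈ γ∈
    ... | no _   = inj₁ (p≤q⇒0≤q-p (α⁺≤1 γ))

  survival²≤1-α⁺*α⁺ : ∀ {a b c x β γ} → 0ℚ < a → 0ℚ < b → 0ℚ < c →
    a ≤ (1ℚ + 1ℚ) * b → a ≤ (1ℚ + 1ℚ) * c → Fractional x → Fractional β → Fractional γ →
    𝔼 (Simplify a b x β) (λ γ₁ _ → ifFractional γ₁ (survival a c γ₁ γ)) ≤ 1ℚ - α⁺ β * α⁺ γ
  survival²≤1-α⁺*α⁺ {a} {b} {c} {x} {β} {γ} a>0 b>0 c>0 a≤2b a≤2c x∈ β∈ γ∈ = byCase (simplifyCase a b x β)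
    where
    S : ℚ → ℚ → ℚ
    S γ₁ _ = survival a c γ₁ γ
    S≤1 : ∀ γ₁ → Fractional γ₁ → survival a c γ₁ γ ≤ 1ℚ
    S≤1 γ₁ γ₁∈ = survival≤1 a>0 c>0 γ₁∈ γ∈
    α⁺α⁺≤β : α⁺ β * α⁺ γ ≤ β
    α⁺α⁺≤β = ≤-trans (α⁺*α⁺≤α⁺ β γ) (α⁺≤x β∈)
    α⁺α⁺≤1-β : α⁺ β * α⁺ γ ≤ 1ℚ - β
    α⁺α⁺≤1-β = ≤-trans (α⁺*α⁺≤α⁺ β γ) (α⁺≤1-x β∈)
    byCase : ∀ {os} → SimplifyCase a b x β os →
             𝔼 os (λ γ₁ γ₂ → ifFractional γ₁ (S γ₁ γ₂)) ≤ 1ℚ - α⁺ β * α⁺ γ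
    byCase (caseI load≤a⊓b) = ≤-trans
      (𝔼-outcomesI≤1-qI a b x β S (qI≤1 a>0 b>0 x∈ β∈) (S≤1 _))
      (1-‿antimono-≤ (≤-trans α⁺α⁺≤β (y≤qI a>0 b>0 x∈ β∈ (≤-trans load≤a⊓b (p⊓q≤q a b)))))
    byCase caseII = subst (_≤ 1ℚ - α⁺ β * α⁺ γ) (sym (𝔼-outcomesII≡0 a b x β S)) (1-α⁺*α⁺-nonNeg β γ)
    byCase (caseIII _ _) = subst (_≤ 1ℚ - α⁺ β * α⁺ γ)
      (sym (𝔼-pair β y₁ 1ℚ (1ℚ - β) y₀ 0ℚ (λ γ₁ γ₂ → ifFractional γ₁ (S γ₁ γ₂))))
      (coin≤1-α⁺*α⁺ {γ = γ} β∈ (ifFractional-survival≤1 a>0 c>0 γ∈ y₁) (ifFractional-survival≤1 a>0 c>0 γ∈ y₀)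
        (notBothCaseIII (ifFractional-survival≤1-α⁺⊎caseIII a>0 c>0 γ∈ y₁)
                              (ifFractional-survival≤1-α⁺⊎caseIII a>0 c>0 γ∈ y₀)))
      where
      y₁ = γ₁-if-γ₂=1 a b x β
      y₀ = γ₁-if-γ₂=0 a b x β
      notBothCaseIII : ∀ {g₁ g₀} →
        g₁ ≤ 1ℚ - α⁺ γ ⊎ (c < load a c y₁ γ × load a c y₁ γ < a) →
        g₀ ≤ 1ℚ - α⁺ γ ⊎ (c < load a c y₀ γ × load a c y₀ γ < a) →
        g₁ ≤ 1ℚ - α⁺ γ ⊎ g₀ ≤ 1ℚ - α⁺ γ
      notBothCaseIII (inj₁ g₁≤) _                = inj₁ g₁≤
      notBothCaseIII (inj₂ _) (inj₁ g₀≤)         = inj₂ g₀≤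
      notBothCaseIII (inj₂ (c<L₁ , _)) (inj₂ (_ , L₀<a)) =
        ⊥-elim (noConsecutiveCaseIII {a} {b} {c} {x} {β} {γ} a>0 a≤2b a≤2c c<L₁ L₀<a)
    byCase (caseIV a⊔b≤load) = ≤-trans
      (𝔼-outcomesIV≤1-qIV a b x β S (qIV≤1 a>0 b>0 x∈ β∈) (S≤1 _))
      (1-‿antimono-≤ (≤-trans α⁺α⁺≤1-β (1-y≤qIV a>0 b>0 x∈ β∈ (≤-trans (p≤p⊔q a b) a⊔b≤load))))
    byCase noCase = 1-α⁺*α⁺-nonNeg β γ

  Entry : Set
  Entry = ℚ × ℚ

  AllIntegral : List Entry → Set
  AllIntegral = All (λ e → ¬ Fractional (proj₂ e))

  Comparable : ℚ → List Entry → Set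
  Comparable a = All (λ e → 0ℚ < proj₁ e × a ≤ (1ℚ + 1ℚ) * proj₁ e)

  pairProduct⁺ : List Entry → ℚ
  pairProduct⁺ ((_ , β) ∷ (_ , γ) ∷ es) = (1ℚ - α⁺ β * α⁺ γ) * pairProduct⁺ es
  pairProduct⁺ _                        = 1ℚ

  -- For an entry u of weight a and value x that is the earliest fractional entry,
  -- an upper bound on the probability that u is co-rounded with v when es are the
  -- entries strictly between them, paired off as in δ.  When the first entry β of
  -- a pair is already integral, only u's survival against γ is charged.
  coRoundBound : (a x : ℚ) → List Entry → ℚ
  coRoundBound a x ((_ , β) ∷ (c , γ) ∷ es) with fractional? β | fractional? γ
  ... | yes _ | _     = (1ℚ - α⁺ β * α⁺ γ) * pairProduct⁺ es
  ... | no _  | yes _ = survival a c x γ * pairProduct⁺ es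
  ... | no _  | no _  = coRoundBound a x es
  coRoundBound a x _ = 1ℚ

  pairProduct⁺-nonNeg : ∀ es → 0ℚ ≤ pairProduct⁺ es
  pairProduct⁺-nonNeg ((_ , β) ∷ (_ , γ) ∷ es) = *-nonNeg (1-α⁺*α⁺-nonNeg β γ) (pairProduct⁺-nonNeg es)
  pairProduct⁺-nonNeg []                       = 0≤1
  pairProduct⁺-nonNeg (_ ∷ [])                 = 0≤1

  pairProduct⁺-integral₁ : ∀ {β} b e es → ¬ Fractional β → pairProduct⁺ ((b , β) ∷ e ∷ es) ≡ pairProduct⁺ es
  pairProduct⁺-integral₁ {β} b (c , γ) es β∉ = begin
    (1ℚ - α⁺ β * α⁺ γ) * pairProduct⁺ es ≡⟨ cong (λ z → (1ℚ - z * α⁺ γ) * pairProduct⁺ es) (α⁺-integral β∉) ⟩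
    (1ℚ - 0ℚ * α⁺ γ) * pairProduct⁺ es   ≡⟨ solve 2 (λ g p → (con 1ℚ :- con 0ℚ :* g) :* p := p) refl (α⁺ γ) _ ⟩
    pairProduct⁺ es                      ∎
    where open ≡-Reasoning

  pairProduct⁺-integral₂ : ∀ {γ} e c es → ¬ Fractional γ → pairProduct⁺ (e ∷ (c , γ) ∷ es) ≡ pairProduct⁺ es
  pairProduct⁺-integral₂ {γ} (b , β) c es γ∉ = begin
    (1ℚ - α⁺ β * α⁺ γ) * pairProduct⁺ es ≡⟨ cong (λ z → (1ℚ - α⁺ β * z) * pairProduct⁺ es) (α⁺-integral γ∉) ⟩
    (1ℚ - α⁺ β * 0ℚ) * pairProduct⁺ es   ≡⟨ solve 2 (λ g p → (con 1ℚ :- g :* con 0ℚ) :* p := p) refl (α⁺ β) _ ⟩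
    pairProduct⁺ es                      ∎
    where open ≡-Reasoning

  module _ {a x : ℚ} where

    coRoundBound-fractional₁ : ∀ {β γ} b c es → Fractional β →
      coRoundBound a x ((b , β) ∷ (c , γ) ∷ es) ≡ (1ℚ - α⁺ β * α⁺ γ) * pairProduct⁺ es
    coRoundBound-fractional₁ {β} b c es β∈ with fractional? β
    ... | yes _  = refl
    ... | no β∉ = ⊥-elim (β∉ β∈)

    coRoundBound-fractional₂ : ∀ {β γ} b c es → ¬ Fractional β → Fractional γ →
      coRoundBound a x ((b , β) ∷ (c , γ) ∷ es) ≡ survival a c x γ * pairProduct⁺ es
    coRoundBound-fractional₂ {β} {γ} b c es β∉ γ∈ with fractional? β | fractional? γ
    ... | yes β∈ | _      = ⊥-elim (β∉ β∈)
    ... | no _   | yes _  = refl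
    ... | no _   | no γ∉ = ⊥-elim (γ∉ γ∈)

    coRoundBound-integral : ∀ {β γ} b c es → ¬ Fractional β → ¬ Fractional γ →
      coRoundBound a x ((b , β) ∷ (c , γ) ∷ es) ≡ coRoundBound a x es
    coRoundBound-integral {β} {γ} b c es β∉ γ∉ with fractional? β | fractional? γ
    ... | yes β∈ | _      = ⊥-elim (β∉ β∈)
    ... | no _   | yes γ∈ = ⊥-elim (γ∉ γ∈)
    ... | no _   | no _   = refl

    coRoundBound-allIntegral : ∀ es → AllIntegral es → coRoundBound a x es ≡ 1ℚ
    coRoundBound-allIntegral ((b , _) ∷ (c , _) ∷ es) (β∉ ∷ γ∉ ∷ es∉) =
      trans (coRoundBound-integral b c es β∉ γ∉) (coRoundBound-allIntegral es es∉)
    coRoundBound-allIntegral []       _ = refl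
    coRoundBound-allIntegral (_ ∷ []) _ = refl

    module _ (a>0 : 0ℚ < a) (x∈ : Fractional x) where

      coRoundBound-nonNeg : ∀ es → Comparable a es → 0ℚ ≤ coRoundBound a x es
      coRoundBound-nonNeg ((b , β) ∷ (c , γ) ∷ es) (_ ∷ (c>0 , _) ∷ cmp) with fractional? β | fractional? γ
      ... | yes _ | _      = *-nonNeg (1-α⁺*α⁺-nonNeg β γ) (pairProduct⁺-nonNeg es)
      ... | no _  | yes γ∈ = *-nonNeg (survival-nonNeg a>0 c>0 x∈ γ∈) (pairProduct⁺-nonNeg es)
      ... | no _  | no _   = coRoundBound-nonNeg es cmp
      coRoundBound-nonNeg []       _ = 0≤1
      coRoundBound-nonNeg (_ ∷ []) _ = 0≤1

      coRoundBound≤pairProduct⁺ : ∀ es → Comparable a es → coRoundBound a x es ≤ pairProduct⁺ es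
      coRoundBound≤pairProduct⁺ ((b , β) ∷ (c , γ) ∷ es) (_ ∷ (c>0 , _) ∷ cmp)
        with fractional? β | fractional? γ
      ... | yes _  | _      = ≤-refl
      ... | no β∉ | yes γ∈ = subst (_ ≤_) (sym (pairProduct⁺-integral₁ b (c , γ) es β∉))
        (subst (survival a c x γ * pairProduct⁺ es ≤_) (*-identityˡ (pairProduct⁺ es))
          (*-monoʳ-≤ (pairProduct⁺-nonNeg es) (survival≤1 a>0 c>0 x∈ γ∈)))
      ... | no β∉ | no _   = subst (coRoundBound a x es ≤_) (sym (pairProduct⁺-integral₁ b (c , γ) es β∉))
        (coRoundBound≤pairProduct⁺ es cmp)
      coRoundBound≤pairProduct⁺ []       _ = ≤-refl
      coRoundBound≤pairProduct⁺ (_ ∷ []) _ = ≤-refl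

  coRoundBoundAfter : (a b : ℚ) → List Entry → List Entry → ℚ → ℚ → ℚ
  coRoundBoundAfter a b zs es γ₁ γ₂ = ifFractional γ₁ (coRoundBound a γ₁ (zs ++ (b , γ₂) ∷ es))

  module _ {a b x β : ℚ} (a>0 : 0ℚ < a) (x∈ : Fractional x) (β∈ : Fractional β) where

    coRoundBound-stepEnd : ∀ z ζ es → Comparable a ((z , ζ) ∷ (b , β) ∷ es) → ¬ Fractional ζ →
      𝔼 (Simplify a b x β) (coRoundBoundAfter a b ((z , ζ) ∷ []) es) ≤ coRoundBound a x ((z , ζ) ∷ (b , β) ∷ es)
    coRoundBound-stepEnd z ζ es (cz ∷ cb@(b>0 , _) ∷ cmp) ζ∉ = begin
      𝔼 (Simplify a b x β) (coRoundBoundAfter a b ((z , ζ) ∷ []) es)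
        ≤⟨ 𝔼-mono (proj₁ (Simplify-isSubDistribution a>0 b>0 x∈ β∈))
                  (All.universal (λ (_ , γ₁ , γ₂) → pointwise γ₁ γ₂) _) ⟩
      𝔼 (Simplify a b x β) (λ γ₁ _ → ifFractional γ₁ 1ℚ * pairProduct⁺ es)
        ≡⟨ 𝔼-*ʳ (Simplify a b x β) (λ γ₁ _ → ifFractional γ₁ 1ℚ) (pairProduct⁺ es) ⟩
      survival a b x β * pairProduct⁺ es
        ≡⟨ sym (coRoundBound-fractional₂ z b es ζ∉ β∈) ⟩
      coRoundBound a x ((z , ζ) ∷ (b , β) ∷ es) ∎
      where
      open ≤-Reasoning
      pointwise : ∀ γ₁ γ₂ → coRoundBoundAfter a b ((z , ζ) ∷ []) es γ₁ γ₂ ≤ ifFractional γ₁ 1ℚ * pairProduct⁺ es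
      pointwise γ₁ γ₂ with fractional? γ₁
      ... | yes γ₁∈ = subst (coRoundBound a γ₁ ((z , ζ) ∷ (b , γ₂) ∷ es) ≤_)
        (trans (pairProduct⁺-integral₁ z (b , γ₂) es ζ∉) (sym (*-identityˡ (pairProduct⁺ es))))
        (coRoundBound≤pairProduct⁺ a>0 γ₁∈ ((z , ζ) ∷ (b , γ₂) ∷ es) (cz ∷ cb ∷ cmp))
      ... | no _    = ≤-reflexive (sym (*-zeroˡ (pairProduct⁺ es)))

    coRoundBound-stepStart : ∀ c γ es → Comparable a ((b , β) ∷ (c , γ) ∷ es) → Dec (Fractional γ) →
      𝔼 (Simplify a b x β) (coRoundBoundAfter a b [] ((c , γ) ∷ es)) ≤ coRoundBound a x ((b , β) ∷ (c , γ) ∷ es)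
    coRoundBound-stepStart c γ es ((b>0 , a≤2b) ∷ (c>0 , a≤2c) ∷ _) (yes γ∈) = begin
      𝔼 (Simplify a b x β) (coRoundBoundAfter a b [] ((c , γ) ∷ es))
        ≤⟨ 𝔼-mono (proj₁ subDistribution) (All.map (λ {o} → pointwise o) (Simplify-roundsOne a b x β)) ⟩
      𝔼 (Simplify a b x β) (λ γ₁ _ → ifFractional γ₁ (survival a c γ₁ γ) * pairProduct⁺ es)
        ≡⟨ 𝔼-*ʳ (Simplify a b x β) (λ γ₁ _ → ifFractional γ₁ (survival a c γ₁ γ)) (pairProduct⁺ es) ⟩
      𝔼 (Simplify a b x β) (λ γ₁ _ → ifFractional γ₁ (survival a c γ₁ γ)) * pairProduct⁺ es
        ≤⟨ *-monoʳ-≤ (pairProduct⁺-nonNeg es) (survival²≤1-α⁺*α⁺ a>0 b>0 c>0 a≤2b a≤2c x∈ β∈ γ∈) ⟩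
      (1ℚ - α⁺ β * α⁺ γ) * pairProduct⁺ es
        ≡⟨ sym (coRoundBound-fractional₁ b c es β∈) ⟩
      coRoundBound a x ((b , β) ∷ (c , γ) ∷ es) ∎
      where
      open ≤-Reasoning
      subDistribution = Simplify-isSubDistribution a>0 b>0 x∈ β∈
      pointwise : ∀ ((_ , γ₁ , γ₂) : Outcome) → (Fractional γ₁ → ¬ Fractional γ₂) →
        coRoundBoundAfter a b [] ((c , γ) ∷ es) γ₁ γ₂ ≤ ifFractional γ₁ (survival a c γ₁ γ) * pairProduct⁺ es
      pointwise (_ , γ₁ , γ₂) roundsOne with fractional? γ₁
      ... | yes γ₁∈ = ≤-reflexive (coRoundBound-fractional₂ b c es (roundsOne γ₁∈) γ∈)
      ... | no _    = ≤-reflexive (sym (*-zeroˡ (pairProduct⁺ es)))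
    coRoundBound-stepStart c γ es (cb@(b>0 , _) ∷ cc ∷ cmp) (no γ∉) = begin
      𝔼 (Simplify a b x β) (coRoundBoundAfter a b [] ((c , γ) ∷ es))
        ≤⟨ 𝔼-≤ subDistribution (pairProduct⁺-nonNeg es) pointwise ⟩
      pairProduct⁺ es
        ≡⟨ sym (trans (coRoundBound-fractional₁ b c es β∈) (pairProduct⁺-integral₂ (b , β) c es γ∉)) ⟩
      coRoundBound a x ((b , β) ∷ (c , γ) ∷ es) ∎
      where
      open ≤-Reasoning
      subDistribution = Simplify-isSubDistribution a>0 b>0 x∈ β∈
      pointwise : ∀ γ₁ γ₂ → coRoundBoundAfter a b [] ((c , γ) ∷ es) γ₁ γ₂ ≤ pairProduct⁺ es
      pointwise γ₁ γ₂ = ifFractional-≤ γ₁ (pairProduct⁺-nonNeg es) λ γ₁∈ →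
        subst (coRoundBound a γ₁ ((b , γ₂) ∷ (c , γ) ∷ es) ≤_) (pairProduct⁺-integral₂ (b , γ₂) c es γ∉)
          (coRoundBound≤pairProduct⁺ a>0 γ₁∈ ((b , γ₂) ∷ (c , γ) ∷ es) (cb ∷ cc ∷ cmp))

    coRoundBound-step : ∀ zs es → Comparable a (zs ++ (b , β) ∷ es) → AllIntegral zs →
      𝔼 (Simplify a b x β) (coRoundBoundAfter a b zs es) ≤ coRoundBound a x (zs ++ (b , β) ∷ es)
    coRoundBound-step ((z₁ , _) ∷ (z₂ , _) ∷ zs) es (_ ∷ _ ∷ cmp) (ζ₁∉ ∷ ζ₂∉ ∷ zs∉) =
      subst₂ _≤_
        (𝔼-cong (Simplify a b x β)
          (λ γ₁ γ₂ → cong (ifFractional γ₁) (sym (coRoundBound-integral z₁ z₂ (zs ++ (b , γ₂) ∷ es) ζ₁∉ ζ₂∉))))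
        (sym (coRoundBound-integral z₁ z₂ (zs ++ (b , β) ∷ es) ζ₁∉ ζ₂∉))
        (coRoundBound-step zs es cmp zs∉)
    coRoundBound-step ((z , ζ) ∷ []) es cmp (ζ∉ ∷ []) = coRoundBound-stepEnd z ζ es cmp ζ∉
    coRoundBound-step [] [] ((b>0 , _) ∷ []) [] =
      𝔼-≤ (Simplify-isSubDistribution a>0 b>0 x∈ β∈) 0≤1 (λ γ₁ _ → ifFractional-≤ γ₁ 0≤1 (λ _ → ≤-refl))
    coRoundBound-step [] ((c , γ) ∷ es) cmp [] = coRoundBound-stepStart c γ es cmp (fractional? γ)

  module Run {n : ℕ} (A : Fin n → ℚ) (π : Permutation′ n) (A>0 : ∀ i → 0ℚ < A i)
             (A≤2A : ∀ i j → A i ≤ (1ℚ + 1ℚ) * A j) (u v : Fin n) where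

    State : Set
    State = Fin n → ℚ

    coRoundedOr : State → ℕ → State → ℚ
    coRoundedOr X f Y = if changed A π X Y u ∧ changed A π X Y v then 1ℚ else prCoRound A π u v f Y

    prCoRound-step : ∀ f X {i j} → firstTwo A π X ≡ just (i , j) →
      prCoRound A π u v (suc f) X ≡
      𝔼 (Simplify (A i) (A j) (X i) (X j)) (λ γ₁ γ₂ → coRoundedOr X f (update2 A π X i j γ₁ γ₂))
    prCoRound-step f X {i} {j} eq rewrite eq =
      foldr-𝔼 (Simplify (A i) (A j) (X i) (X j))
      where
      foldr-𝔼 : ∀ os → foldr (λ { (q , γ₁ , γ₂) acc → q * coRoundedOr X f (update2 A π X i j γ₁ γ₂) + acc }) 0ℚ os
                       ≡ 𝔼 os (λ γ₁ γ₂ → coRoundedOr X f (update2 A π X i j γ₁ γ₂))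
      foldr-𝔼 []                    = refl
      foldr-𝔼 ((q , γ₁ , γ₂) ∷ os) = cong (q * coRoundedOr X f (update2 A π X i j γ₁ γ₂) +_) (foldr-𝔼 os)

    prCoRound-stop : ∀ f X → firstTwo A π X ≡ nothing → prCoRound A π u v (suc f) X ≡ 0ℚ
    prCoRound-stop f X eq rewrite eq = refl

    firstTwo-cases : ∀ X → firstTwo A π X ≡ nothing ⊎ Σ[ i ∈ Fin n ] Σ[ j ∈ Fin n ] firstTwo A π X ≡ just (i , j)
    firstTwo-cases X with firstTwo A π X
    ... | nothing      = inj₁ refl
    ... | just (i , j) = inj₂ (i , j , refl)

    firstTwo-of : ∀ X {i j r} → fracInOrder A π X ≡ i ∷ j ∷ r → firstTwo A π X ≡ just (i , j)
    firstTwo-of X eq rewrite eq = refl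

    firstTwo-fractional : ∀ X {i j} → firstTwo A π X ≡ just (i , j) → Fractional (X i) × Fractional (X j)
    firstTwo-fractional X {i} {j} eq with fracInOrder A π X in fracs
    firstTwo-fractional X {i} {j} refl | i ∷ j ∷ _ =
      proj₂ (∈-filter⁻ (fractional? ∘ X) {xs = πOrder A π} (subst (i ∈_) (sym fracs) (here refl))) ,
      proj₂ (∈-filter⁻ (fractional? ∘ X) {xs = πOrder A π} (subst (j ∈_) (sym fracs) (there (here refl))))

    firstTwo-isSubDistribution : ∀ X {i j} → firstTwo A π X ≡ just (i , j) →
      IsSubDistribution (Simplify (A i) (A j) (X i) (X j))
    firstTwo-isSubDistribution X {i} {j} eq =
      Simplify-isSubDistribution (A>0 i) (A>0 j) (proj₁ (firstTwo-fractional X eq)) (proj₂ (firstTwo-fractional X eq))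

    update2-first : ∀ X i j γ₁ γ₂ → update2 A π X i j γ₁ γ₂ i ≡ γ₁
    update2-first X i j γ₁ γ₂ with i Fin.≟ i
    ... | yes _  = refl
    ... | no i≢i = ⊥-elim (i≢i refl)

    update2-second : ∀ X i j γ₁ γ₂ → j ≢ i → update2 A π X i j γ₁ γ₂ j ≡ γ₂
    update2-second X i j γ₁ γ₂ j≢i with j Fin.≟ i | j Fin.≟ j
    ... | yes j≡i | _      = ⊥-elim (j≢i j≡i)
    ... | no _    | yes _  = refl
    ... | no _    | no j≢j = ⊥-elim (j≢j refl)

    update2-other : ∀ X i j γ₁ γ₂ k → k ≢ i → k ≢ j → update2 A π X i j γ₁ γ₂ k ≡ X k
    update2-other X i j γ₁ γ₂ k k≢i k≢j with k Fin.≟ i | k Fin.≟ j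
    ... | yes k≡i | _       = ⊥-elim (k≢i k≡i)
    ... | no _    | yes k≡j = ⊥-elim (k≢j k≡j)
    ... | no _    | no _    = refl

    changed-unchanged : ∀ X Y k → Y k ≡ X k → changed A π X Y k ≡ false
    changed-unchanged X Y k eq =
      trans (cong (λ z → if does (X k ≟ z) then false else true) eq)
            (cong (λ b → if b then false else true) (dec-true (X k ≟ X k) refl))

    coRoundedOr-u : ∀ X f Y → Y u ≡ X u → coRoundedOr X f Y ≡ prCoRound A π u v f Y
    coRoundedOr-u X f Y eq =
      cong (λ c → if c ∧ changed A π X Y v then 1ℚ else prCoRound A π u v f Y) (changed-unchanged X Y u eq)

    coRoundedOr-v : ∀ X f Y → Y v ≡ X v → coRoundedOr X f Y ≡ prCoRound A π u v f Y
    coRoundedOr-v X f Y eq = cong (λ c → if c then 1ℚ else prCoRound A π u v f Y)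
      (trans (cong (changed A π X Y u ∧_) (changed-unchanged X Y v eq)) (∧-zeroʳ _))

    coRoundedOr≤1 : ∀ X f Y → prCoRound A π u v f Y ≤ 1ℚ → coRoundedOr X f Y ≤ 1ℚ
    coRoundedOr≤1 X f Y pr≤1 with changed A π X Y u ∧ changed A π X Y v
    ... | true  = ≤-refl
    ... | false = pr≤1

    prCoRound≤1 : ∀ f X → prCoRound A π u v f X ≤ 1ℚ
    prCoRound≤1 zero    X = 0≤1
    prCoRound≤1 (suc f) X with firstTwo-cases X
    ... | inj₁ eq           = subst (_≤ 1ℚ) (sym (prCoRound-stop f X eq)) 0≤1
    ... | inj₂ (i , j , eq) = subst (_≤ 1ℚ) (sym (prCoRound-step f X eq))
      (𝔼-≤ (firstTwo-isSubDistribution X eq) 0≤1 (λ γ₁ γ₂ → coRoundedOr≤1 X f _ (prCoRound≤1 f _)))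

    -- Simplify only changes fractional entries, so an integral entry k stays integral
    -- and never takes part in a step.
    prCoRound-integral : ∀ k → (∀ X f Y → Y k ≡ X k → coRoundedOr X f Y ≡ prCoRound A π u v f Y) →
      ∀ f X → ¬ Fractional (X k) → prCoRound A π u v f X ≤ 0ℚ
    prCoRound-integral k unchanged zero    X k∉ = ≤-refl
    prCoRound-integral k unchanged (suc f) X k∉ with firstTwo-cases X
    ... | inj₁ eq           = ≤-reflexive (prCoRound-stop f X eq)
    ... | inj₂ (i , j , eq) = subst (_≤ 0ℚ) (sym (prCoRound-step f X eq))
      (𝔼-≤ (firstTwo-isSubDistribution X eq) ≤-refl pointwise)
      where
      k≢i : k ≢ i
      k≢i refl = k∉ (proj₁ (firstTwo-fractional X eq))
      k≢j : k ≢ j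
      k≢j refl = k∉ (proj₂ (firstTwo-fractional X eq))
      pointwise : ∀ γ₁ γ₂ → coRoundedOr X f (update2 A π X i j γ₁ γ₂) ≤ 0ℚ
      pointwise γ₁ γ₂ = let Yk≡Xk = update2-other X i j γ₁ γ₂ k k≢i k≢j in
        subst (_≤ 0ℚ) (sym (unchanged X f _ Yk≡Xk))
          (prCoRound-integral k unchanged f _ (subst (¬_ ∘ Fractional) (sym Yk≡Xk) k∉))

    prCoRound-integralᵘ : ∀ f X → ¬ Fractional (X u) → prCoRound A π u v f X ≤ 0ℚ
    prCoRound-integralᵘ = prCoRound-integral u coRoundedOr-u

    prCoRound-integralᵛ : ∀ f X → ¬ Fractional (X v) → prCoRound A π u v f X ≤ 0ℚ
    prCoRound-integralᵛ = prCoRound-integral v coRoundedOr-v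

    entries : State → List (Fin n) → List Entry
    entries X = map (λ k → A k , X k)

    entries-comparable : ∀ X ks → Comparable (A u) (entries X ks)
    entries-comparable X ks = map⁺ (All.universal (λ k → A>0 k , A≤2A u k) ks)

    entries-update2-other : ∀ X i j γ₁ γ₂ ks → All (λ k → k ≢ i × k ≢ j) ks →
      entries (update2 A π X i j γ₁ γ₂) ks ≡ entries X ks
    entries-update2-other X i j γ₁ γ₂ ks ks≢ij = map-cong-local
      (All.map (λ {k} (k≢i , k≢j) → cong (A k ,_) (update2-other X i j γ₁ γ₂ k k≢i k≢j)) ks≢ij)

    -- u = σ(k) and v = σ(k+1) split the π-order as pre ++ u ∷ mid ++ v ∷ post,
    -- with mid = J_k.
    module Layout (pre mid post : List (Fin n))
                  (layout : πOrder A π ≡ pre ++ u ∷ mid ++ v ∷ post)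
                  (distinct : AllPairs _≢_ (pre ++ u ∷ mid ++ v ∷ post)) where

      private
        pre≢rest : All (λ c → All (c ≢_) (u ∷ mid ++ v ∷ post)) pre
        pre≢rest = proj₂ (proj₂ (AllPairs-++⁻ pre distinct))

        rest-distinct : AllPairs _≢_ (u ∷ mid ++ v ∷ post)
        rest-distinct = proj₁ (proj₂ (AllPairs-++⁻ pre distinct))

        u≢rest : All (u ≢_) (mid ++ v ∷ post)
        u≢rest = AllPairs.head rest-distinct

        midvpost-distinct : AllPairs _≢_ (mid ++ v ∷ post)
        midvpost-distinct = AllPairs.tail rest-distinct

      pre≢u : ∀ {c} → c ∈ pre → c ≢ u
      pre≢u c∈ = All.head (All.lookup pre≢rest c∈)

      pre≢v : ∀ {c} → c ∈ pre → c ≢ v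
      pre≢v c∈ = All.head (++⁻ʳ mid (All.tail (All.lookup pre≢rest c∈)))

      pre≢mid : ∀ {c} → c ∈ pre → All (c ≢_) mid
      pre≢mid c∈ = ++⁻ˡ mid (All.tail (All.lookup pre≢rest c∈))

      u≢mid : All (u ≢_) mid
      u≢mid = ++⁻ˡ mid u≢rest

      u≢v : u ≢ v
      u≢v = All.head (++⁻ʳ mid u≢rest)

      mid≢v : All (_≢ v) mid
      mid≢v = All.map All.head (proj₂ (proj₂ (AllPairs-++⁻ mid midvpost-distinct)))

      mid-distinct : AllPairs _≢_ mid
      mid-distinct = proj₁ (AllPairs-++⁻ mid midvpost-distinct)

      fracInOrder-layout : ∀ X → Fractional (X u) → Fractional (X v) →
        fracInOrder A π X ≡
          filter (fractional? ∘ X) pre ++ u ∷ filter (fractional? ∘ X) mid ++ v ∷ filter (fractional? ∘ X) post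
      fracInOrder-layout X u∈ v∈ = begin
        filter F? (πOrder A π)                            ≡⟨ cong (filter F?) layout ⟩
        filter F? (pre ++ u ∷ mid ++ v ∷ post)            ≡⟨ filter-++ F? pre _ ⟩
        filter F? pre ++ filter F? (u ∷ mid ++ v ∷ post)  ≡⟨ cong (filter F? pre ++_) (filter-accept F? u∈) ⟩
        filter F? pre ++ u ∷ filter F? (mid ++ v ∷ post)
          ≡⟨ cong (λ l → filter F? pre ++ u ∷ l) (filter-++ F? mid _) ⟩
        filter F? pre ++ u ∷ filter F? mid ++ filter F? (v ∷ post)
          ≡⟨ cong (λ l → filter F? pre ++ u ∷ filter F? mid ++ l) (filter-accept F? v∈) ⟩
        filter F? pre ++ u ∷ filter F? mid ++ v ∷ filter F? post ∎
        where
        open ≡-Reasoning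
        F? = fractional? ∘ X

      PreIntegral : State → Set
      PreIntegral X = All (λ c → ¬ Fractional (X c)) pre

      fracInOrder-u-first : ∀ X → Fractional (X u) → Fractional (X v) → PreIntegral X →
        fracInOrder A π X ≡ u ∷ filter (fractional? ∘ X) mid ++ v ∷ filter (fractional? ∘ X) post
      fracInOrder-u-first X u∈ v∈ pre∉ =
        trans (fracInOrder-layout X u∈ v∈) (cong (_++ _) (filter-none (fractional? ∘ X) pre∉))

      CoRoundBounded : ℕ → Set
      CoRoundBounded f = ∀ X → Fractional (X u) → Fractional (X v) → PreIntegral X →
        prCoRound A π u v f X ≤ coRoundBound (A u) (X u) (entries X mid)

      coRoundBounded-v : ∀ f X → Fractional (X u) → Fractional (X v) → PreIntegral X →
        filter (fractional? ∘ X) mid ≡ [] → prCoRound A π u v (suc f) X ≤ coRoundBound (A u) (X u) (entries X mid)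
      coRoundBounded-v f X u∈ v∈ pre∉ noFracMid = subst₂ _≤_
        (sym (prCoRound-step f X (firstTwo-of X
          (trans (fracInOrder-u-first X u∈ v∈ pre∉) (cong (λ l → u ∷ l ++ v ∷ _) noFracMid)))))
        (sym (coRoundBound-allIntegral (entries X mid) (map⁺ (filter-≡[]⁻ (fractional? ∘ X) mid noFracMid))))
        (𝔼-≤ (Simplify-isSubDistribution (A>0 u) (A>0 v) u∈ v∈) 0≤1
             (λ γ₁ γ₂ → coRoundedOr≤1 X f _ (prCoRound≤1 f _)))

      entries-split : ∀ Z {zs j rest} → mid ≡ zs ++ j ∷ rest →
        entries Z mid ≡ entries Z zs ++ (A j , Z j) ∷ entries Z rest
      entries-split Z {zs} {j} {rest} mid≡ = trans (cong (entries Z) mid≡) (map-++ _ zs (j ∷ rest))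

      entries-coRound : ∀ X {zs j rest} → mid ≡ zs ++ j ∷ rest → All (λ k → ¬ Fractional (X k)) zs →
        Fractional (X u) → Fractional (X j) → ∀ γ₁ γ₂ →
        entries (update2 A π X u j γ₁ γ₂) mid ≡ entries X zs ++ (A j , γ₂) ∷ entries X rest
      entries-coRound X {zs} {j} {rest} mid≡ zs∉ u∈ j∈ γ₁ γ₂ =
        trans (entries-split (update2 A π X u j γ₁ γ₂) mid≡) (cong₂ _++_
          (entries-update2-other X u j γ₁ γ₂ zs (All.map (λ k∉ → differs k∉ u∈ , differs k∉ j∈) zs∉))
          (cong₂ _∷_ (cong (A j ,_) (update2-second X u j γ₁ γ₂ j≢u))
                     (entries-update2-other X u j γ₁ γ₂ rest rest≢uj)))
        where
        differs : ∀ {k i} → ¬ Fractional (X k) → Fractional (X i) → k ≢ i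
        differs k∉ i∈ refl = k∉ i∈
        j≢u : j ≢ u
        j≢u j≡u = All.lookup u≢mid (subst (j ∈_) (sym mid≡) (∈-++⁺ʳ zs (here refl))) (sym j≡u)
        rest≢uj : All (λ k → k ≢ u × k ≢ j) rest
        rest≢uj with proj₁ (proj₂ (AllPairs-++⁻ zs (subst (AllPairs _≢_) mid≡ mid-distinct)))
        ... | j≢rest ∷ _ = All.tabulate λ k∈ →
          (λ k≡u → All.lookup u≢mid (subst (_ ∈_) (sym mid≡) (∈-++⁺ʳ zs (there k∈))) (sym k≡u)) ,
          (λ k≡j → All.lookup j≢rest k∈ (sym k≡j))

      coRoundBounded-mid : ∀ f X {j r} → Fractional (X u) → Fractional (X v) → PreIntegral X →
        filter (fractional? ∘ X) mid ≡ j ∷ r → CoRoundBounded f →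
        prCoRound A π u v (suc f) X ≤ coRoundBound (A u) (X u) (entries X mid)
      coRoundBounded-mid f X {j} {r} u∈ v∈ pre∉ fracMid IH
        with zs , rest , mid≡ , zs∉ , j∈ ← filter-≡∷⁻ (fractional? ∘ X) mid fracMid = begin
        prCoRound A π u v (suc f) X
          ≡⟨ prCoRound-step f X (firstTwo-of X
               (trans (fracInOrder-u-first X u∈ v∈ pre∉) (cong (λ l → u ∷ l ++ v ∷ _) fracMid))) ⟩
        𝔼 (Simplify (A u) (A j) (X u) (X j)) (λ γ₁ γ₂ → coRoundedOr X f (Y γ₁ γ₂))
          ≤⟨ 𝔼-mono (proj₁ (Simplify-isSubDistribution (A>0 u) (A>0 j) u∈ j∈))
                    (All.universal (λ (_ , γ₁ , γ₂) → pointwise γ₁ γ₂) _) ⟩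
        𝔼 (Simplify (A u) (A j) (X u) (X j)) (coRoundBoundAfter (A u) (A j) (entries X zs) (entries X rest))
          ≤⟨ coRoundBound-step (A>0 u) u∈ j∈ (entries X zs) (entries X rest)
               (subst (Comparable (A u)) (entries-split X mid≡) (entries-comparable X mid)) (map⁺ zs∉) ⟩
        coRoundBound (A u) (X u) (entries X zs ++ (A j , X j) ∷ entries X rest)
          ≡⟨ cong (coRoundBound (A u) (X u)) (sym (entries-split X mid≡)) ⟩
        coRoundBound (A u) (X u) (entries X mid) ∎
        where
        open ≤-Reasoning
        Y : ℚ → ℚ → State
        Y = update2 A π X u j
        j∈mid : j ∈ mid
        j∈mid = subst (j ∈_) (sym mid≡) (∈-++⁺ʳ zs (here refl))
        Yv≡Xv : ∀ γ₁ γ₂ → Y γ₁ γ₂ v ≡ X v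
        Yv≡Xv γ₁ γ₂ = update2-other X u j γ₁ γ₂ v (u≢v ∘ sym) (All.lookup mid≢v j∈mid ∘ sym)
        pointwise : ∀ γ₁ γ₂ →
          coRoundedOr X f (Y γ₁ γ₂) ≤ coRoundBoundAfter (A u) (A j) (entries X zs) (entries X rest) γ₁ γ₂
        pointwise γ₁ γ₂ with fractional? γ₁
        ... | yes γ₁∈ = subst₂ _≤_ (sym (coRoundedOr-v X f (Y γ₁ γ₂) (Yv≡Xv γ₁ γ₂)))
          (cong₂ (coRoundBound (A u)) (update2-first X u j γ₁ γ₂) (entries-coRound X mid≡ zs∉ u∈ j∈ γ₁ γ₂))
          (IH (Y γ₁ γ₂) (subst Fractional (sym (update2-first X u j γ₁ γ₂)) γ₁∈)
              (subst Fractional (sym (Yv≡Xv γ₁ γ₂)) v∈) pre∉-after)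
          where
          pre∉-after : PreIntegral (Y γ₁ γ₂)
          pre∉-after = All.tabulate λ {c} c∈ → subst (¬_ ∘ Fractional)
            (sym (update2-other X u j γ₁ γ₂ c (pre≢u c∈) (All.lookup (pre≢mid c∈) j∈mid)))
            (All.lookup pre∉ c∈)
        ... | no γ₁∉ = subst (_≤ 0ℚ) (sym (coRoundedOr-v X f (Y γ₁ γ₂) (Yv≡Xv γ₁ γ₂)))
          (prCoRound-integralᵘ f (Y γ₁ γ₂) (subst (¬_ ∘ Fractional) (sym (update2-first X u j γ₁ γ₂)) γ₁∉))

      prCoRound≤coRoundBound : ∀ f → CoRoundBounded f
      prCoRound≤coRoundBound zero    X u∈ _ _ =
        coRoundBound-nonNeg (A>0 u) u∈ (entries X mid) (entries-comparable X mid)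
      prCoRound≤coRoundBound (suc f) X u∈ v∈ pre∉ with filter (fractional? ∘ X) mid in fracMid
      ... | []    = coRoundBounded-v f X u∈ v∈ pre∉ fracMid
      ... | _ ∷ _ = coRoundBounded-mid f X u∈ v∈ pre∉ fracMid (prCoRound≤coRoundBound f)

      PairProductBounded : ℕ → Set
      PairProductBounded f = ∀ X → Fractional (X u) → Fractional (X v) →
        prCoRound A π u v f X ≤ pairProduct⁺ (entries X mid)

      mid≢pre-u : ∀ {c} → c ∈ pre → All (λ k → k ≢ c × k ≢ u) mid
      mid≢pre-u c∈ = All.zipWith (λ (c≢k , u≢k) → c≢k ∘ sym , u≢k ∘ sym) (pre≢mid c∈ , u≢mid)

      -- The last fractional entry c before u is co-rounded with u, so u and v are not.
      pairProductBounded-lastPre : ∀ f X {c} → Fractional (X u) → Fractional (X v) →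
        filter (fractional? ∘ X) pre ≡ c ∷ [] → PairProductBounded f →
        prCoRound A π u v (suc f) X ≤ pairProduct⁺ (entries X mid)
      pairProductBounded-lastPre f X {c} u∈ v∈ fracPre IH =
        subst (_≤ pairProduct⁺ (entries X mid)) (sym (prCoRound-step f X first))
          (𝔼-≤ (firstTwo-isSubDistribution X first) (pairProduct⁺-nonNeg (entries X mid)) pointwise)
        where
        first : firstTwo A π X ≡ just (c , u)
        first = firstTwo-of X (trans (fracInOrder-layout X u∈ v∈) (cong (_++ _) fracPre))
        c∈pre : c ∈ pre
        c∈pre = proj₁ (∈-filter⁻ (fractional? ∘ X) (subst (c ∈_) (sym fracPre) (here refl)))
        pointwise : ∀ γ₁ γ₂ → coRoundedOr X f (update2 A π X c u γ₁ γ₂) ≤ pairProduct⁺ (entries X mid)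
        pointwise γ₁ γ₂ = subst (_≤ _) (sym (coRoundedOr-v X f Y Yv≡Xv)) (byγ₂ (fractional? γ₂))
          where
          Y = update2 A π X c u γ₁ γ₂
          Yv≡Xv : Y v ≡ X v
          Yv≡Xv = update2-other X c u γ₁ γ₂ v (pre≢v c∈pre ∘ sym) (u≢v ∘ sym)
          Yu≡γ₂ : Y u ≡ γ₂
          Yu≡γ₂ = update2-second X c u γ₁ γ₂ (pre≢u c∈pre ∘ sym)
          byγ₂ : Dec (Fractional γ₂) → prCoRound A π u v f Y ≤ pairProduct⁺ (entries X mid)
          byγ₂ (yes γ₂∈) = subst (prCoRound A π u v f Y ≤_)
            (cong pairProduct⁺ (entries-update2-other X c u γ₁ γ₂ mid (mid≢pre-u c∈pre)))
            (IH Y (subst Fractional (sym Yu≡γ₂) γ₂∈) (subst Fractional (sym Yv≡Xv) v∈))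
          byγ₂ (no γ₂∉)  = ≤-trans (prCoRound-integralᵘ f Y (subst (¬_ ∘ Fractional) (sym Yu≡γ₂) γ₂∉))
                                   (pairProduct⁺-nonNeg (entries X mid))

      pairProductBounded-pre : ∀ f X {c₁ c₂ r} → Fractional (X u) → Fractional (X v) →
        filter (fractional? ∘ X) pre ≡ c₁ ∷ c₂ ∷ r → PairProductBounded f →
        prCoRound A π u v (suc f) X ≤ pairProduct⁺ (entries X mid)
      pairProductBounded-pre f X {c₁} {c₂} u∈ v∈ fracPre IH =
        subst (_≤ pairProduct⁺ (entries X mid)) (sym (prCoRound-step f X first))
          (𝔼-≤ (firstTwo-isSubDistribution X first) (pairProduct⁺-nonNeg (entries X mid)) pointwise)
        where
        first : firstTwo A π X ≡ just (c₁ , c₂)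
        first = firstTwo-of X (trans (fracInOrder-layout X u∈ v∈) (cong (_++ _) fracPre))
        c₁∈pre : c₁ ∈ pre
        c₁∈pre = proj₁ (∈-filter⁻ (fractional? ∘ X) (subst (c₁ ∈_) (sym fracPre) (here refl)))
        c₂∈pre : c₂ ∈ pre
        c₂∈pre = proj₁ (∈-filter⁻ (fractional? ∘ X) (subst (c₂ ∈_) (sym fracPre) (there (here refl))))
        pointwise : ∀ γ₁ γ₂ → coRoundedOr X f (update2 A π X c₁ c₂ γ₁ γ₂) ≤ pairProduct⁺ (entries X mid)
        pointwise γ₁ γ₂ = subst₂ _≤_ (sym (coRoundedOr-u X f Y Yu≡Xu))
          (cong pairProduct⁺ (entries-update2-other X c₁ c₂ γ₁ γ₂ mid
            (All.zipWith (λ (c₁≢k , c₂≢k) → c₁≢k ∘ sym , c₂≢k ∘ sym) (pre≢mid c₁∈pre , pre≢mid c₂∈pre))))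
          (IH Y (subst Fractional (sym Yu≡Xu) u∈) (subst Fractional (sym Yv≡Xv) v∈))
          where
          Y = update2 A π X c₁ c₂ γ₁ γ₂
          Yu≡Xu : Y u ≡ X u
          Yu≡Xu = update2-other X c₁ c₂ γ₁ γ₂ u (pre≢u c₁∈pre ∘ sym) (pre≢u c₂∈pre ∘ sym)
          Yv≡Xv : Y v ≡ X v
          Yv≡Xv = update2-other X c₁ c₂ γ₁ γ₂ v (pre≢v c₁∈pre ∘ sym) (pre≢v c₂∈pre ∘ sym)

      prCoRound≤pairProduct⁺ : ∀ f → PairProductBounded f
      prCoRound≤pairProduct⁺ zero    X _  _  = pairProduct⁺-nonNeg (entries X mid)
      prCoRound≤pairProduct⁺ (suc f) X u∈ v∈ with filter (fractional? ∘ X) pre in fracPre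
      ... | []        = ≤-trans
        (prCoRound≤coRoundBound (suc f) X u∈ v∈ (filter-≡[]⁻ (fractional? ∘ X) pre fracPre))
        (coRoundBound≤pairProduct⁺ (A>0 u) u∈ (entries X mid) (entries-comparable X mid))
      ... | _ ∷ []    = pairProductBounded-lastPre f X u∈ v∈ fracPre (prCoRound≤pairProduct⁺ f)
      ... | _ ∷ _ ∷ _ = pairProductBounded-pre f X u∈ v∈ fracPre (prCoRound≤pairProduct⁺ f)

  module _ {A : Set} (r : A → ℕ) {Q : A → Set} (Q? : ∀ x → Dec (Q x)) where

    filter-strictlyBetween : ∀ pre u mid v post → AllPairs (λ a b → r a ℕ.< r b) (pre ++ u ∷ mid ++ v ∷ post) →
      filter (λ j → (r u ℕ.<? r j) ×-dec (r j ℕ.<? r v) ×-dec Q? j) (pre ++ u ∷ mid ++ v ∷ post) ≡ filter Q? mid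
    filter-strictlyBetween pre u mid v post sorted = begin
      filter B? (pre ++ u ∷ mid ++ v ∷ post)                ≡⟨ filter-++ B? pre _ ⟩
      filter B? pre ++ filter B? (u ∷ mid ++ v ∷ post)
        ≡⟨ cong₂ _++_ (filter-none B? pre∉) (filter-reject B? (ℕ.<-irrefl refl ∘ proj₁)) ⟩
      filter B? (mid ++ v ∷ post)                           ≡⟨ filter-++ B? mid _ ⟩
      filter B? mid ++ filter B? (v ∷ post)                 ≡⟨ cong₂ _++_ (filterMid mid mid∈) (trans
                                                                 (filter-reject B? (ℕ.<-irrefl refl ∘ proj₁ ∘ proj₂))
                                                                 (filter-none B? post∉)) ⟩
      filter Q? mid ++ []                                   ≡⟨ ++-identityʳ _ ⟩
      filter Q? mid                                         ∎
      where
      open ≡-Reasoning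
      B? = λ j → (r u ℕ.<? r j) ×-dec (r j ℕ.<? r v) ×-dec Q? j
      split₁ = AllPairs-++⁻ pre sorted
      u<rest : All (λ j → r u ℕ.< r j) (mid ++ v ∷ post)
      u<rest = AllPairs.head (proj₁ (proj₂ split₁))
      split₂ = AllPairs-++⁻ mid (AllPairs.tail (proj₁ (proj₂ split₁)))
      pre∉ : All (λ j → ¬ (r u ℕ.< r j × r j ℕ.< r v × Q j)) pre
      pre∉ = All.map (λ c<rest (u<c , _) → ℕ.<-asym (All.head c<rest) u<c) (proj₂ (proj₂ split₁))
      mid∈ : All (λ j → r u ℕ.< r j × r j ℕ.< r v) mid
      mid∈ = All.zipWith (λ (u<m , m<v∷) → u<m , All.head m<v∷) (++⁻ˡ mid u<rest , proj₂ (proj₂ split₂))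
      post∉ : All (λ j → ¬ (r u ℕ.< r j × r j ℕ.< r v × Q j)) post
      post∉ = All.map (λ v<j (_ , j<v , _) → ℕ.<-asym v<j j<v) (AllPairs.head (proj₁ (proj₂ split₂)))
      filterMid : ∀ ms → All (λ j → r u ℕ.< r j × r j ℕ.< r v) ms → filter B? ms ≡ filter Q? ms
      filterMid []       []                  = refl
      filterMid (m ∷ ms) ((u<m , m<v) ∷ ms∈) = byQ (Q? m)
        where
        byQ : Dec (Q m) → filter B? (m ∷ ms) ≡ filter Q? (m ∷ ms)
        byQ (yes qm) = trans (filter-accept B? (u<m , m<v , qm))
                             (trans (cong (m ∷_) (filterMid ms ms∈)) (sym (filter-accept Q? qm)))
        byQ (no ¬qm) = trans (filter-reject B? (¬qm ∘ proj₂ ∘ proj₂))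
                             (trans (filterMid ms ms∈) (sym (filter-reject Q? ¬qm)))

  α⁺≡α : ∀ {n} (P : Fin n → ℚ) {i} → 0ℚ ≤ P i → P i ≤ 1ℚ → α⁺ (P i) ≡ α P i
  α⁺≡α P P≥0 P≤1 = p≥q⇒p⊔q≡p (⊓-glb P≥0 (p≤q⇒0≤q-p P≤1))

  pairProduct⁺-values : ∀ {n} (w P : Fin n → ℚ) → (∀ i → 0ℚ ≤ P i) → (∀ i → P i ≤ 1ℚ) →
    ∀ ks → pairProduct⁺ (map (λ k → w k , P k) ks) ≡ pairProduct P ks
  pairProduct⁺-values w P P≥0 P≤1 (i ∷ j ∷ ks) = cong₂ (λ α² p → (1ℚ - α²) * p)
    (cong₂ _*_ (α⁺≡α P (P≥0 i) (P≤1 i)) (α⁺≡α P (P≥0 j) (P≤1 j))) (pairProduct⁺-values w P P≥0 P≤1 ks)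
  pairProduct⁺-values w P P≥0 P≤1 []       = refl
  pairProduct⁺-values w P P≥0 P≤1 (_ ∷ []) = refl

  pairProduct-nonNeg : ∀ {n} (P : Fin n → ℚ) → (∀ i → 0ℚ ≤ P i) → (∀ i → P i ≤ 1ℚ) → ∀ ks → 0ℚ ≤ pairProduct P ks
  pairProduct-nonNeg P P≥0 P≤1 ks =
    subst (0ℚ ≤_) (pairProduct⁺-values P P P≥0 P≤1 ks) (pairProduct⁺-nonNeg (map (λ k → P k , P k) ks))

  module _ {n : ℕ} (π : Permutation′ n) where

    πOrder-sorted : AllPairs (λ i j → toℕ (π ⟨$⟩ˡ i) ℕ.< toℕ (π ⟨$⟩ˡ j)) (map (π ⟨$⟩ʳ_) (allFin n))
    πOrder-sorted = AllPairsₚ.map⁺ (AllPairsₚ.tabulate⁺-< λ i<j →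
      subst₂ ℕ._<_ (sym (cong toℕ (inverseˡ π))) (sym (cong toℕ (inverseˡ π))) i<j)

    πOrder-distinct : AllPairs _≢_ (map (π ⟨$⟩ʳ_) (allFin n))
    πOrder-distinct = AllPairs.map (λ i<j i≡j → ℕ.<-irrefl (cong (toℕ ∘ (π ⟨$⟩ˡ_)) i≡j) i<j) πOrder-sorted

    Jbetween-layout : ∀ I u v pre mid post → map (π ⟨$⟩ʳ_) (allFin n) ≡ pre ++ u ∷ mid ++ v ∷ post →
      All (λ j → ¬ (j ∈ₛ I)) mid → Jbetween π I u v ≡ mid
    Jbetween-layout I u v pre mid post layout mid∉I = begin
      Jbetween π I u v
        ≡⟨ cong (filter _) layout ⟩
      filter _ (pre ++ u ∷ mid ++ v ∷ post)
        ≡⟨ filter-strictlyBetween (toℕ ∘ (π ⟨$⟩ˡ_)) (λ j → ¬? (j ∈? I)) pre u mid v post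
                                  (subst (AllPairs _) layout πOrder-sorted) ⟩
      filter (λ j → ¬? (j ∈? I)) mid
        ≡⟨ filter-all (λ j → ¬? (j ∈? I)) mid∉I ⟩
      mid ∎
      where open ≡-Reasoning

  σ-consecutive : ∀ {n} (π : Permutation′ n) I k {u v} → σ π I k ≡ just u → σ π I (suc k) ≡ just v →
    Σ[ pre ∈ List (Fin n) ] Σ[ mid ∈ List (Fin n) ] Σ[ post ∈ List (Fin n) ]
      map (π ⟨$⟩ʳ_) (allFin n) ≡ pre ++ u ∷ mid ++ v ∷ post × All (λ j → ¬ (j ∈ₛ I)) mid
  σ-consecutive π I (suc k) σk σk+1 = lookupℕ-filter-consecutive (_∈? I) _ k σk σk+1

  PrCoRounded≤pairProduct : ∀ {n} (P A : Fin n → ℚ) → (∀ i → 0ℚ ≤ P i) → (∀ i → P i ≤ 1ℚ) →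
    (∀ i → 0ℚ < A i) → (∀ i j → A i ≤ (1ℚ + 1ℚ) * A j) →
    (π : Permutation′ n) (u v : Fin n) (pre mid post : List (Fin n)) →
    map (π ⟨$⟩ʳ_) (allFin n) ≡ pre ++ u ∷ mid ++ v ∷ post → PrCoRounded A π P u v ≤ pairProduct P mid
  PrCoRounded≤pairProduct {n} P A P≥0 P≤1 A>0 A≤2A π u v pre mid post layout
    with fractional? (P u) | fractional? (P v)
  ... | yes u∈ | yes v∈ = subst (_ ≤_) (pairProduct⁺-values A P P≥0 P≤1 mid) (prCoRound≤pairProduct⁺ n P u∈ v∈)
    where
    open Run A π A>0 A≤2A u v
    open Layout pre mid post layout (subst (AllPairs _≢_) layout (πOrder-distinct π))
  ... | no u∉   | _     = ≤-trans (Run.prCoRound-integralᵘ A π A>0 A≤2A u v n P u∉)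
                                  (pairProduct-nonNeg P P≥0 P≤1 mid)
  ... | yes _  | no v∉  = ≤-trans (Run.prCoRound-integralᵛ A π A>0 A≤2A u v n P v∉)
                                  (pairProduct-nonNeg P P≥0 P≤1 mid)

open import Defs
open import Data.Nat using (ℕ; _≤_; _<_; suc)
open import Data.Fin using (Fin)
open import Data.Fin.Subset using (Subset; ∣_∣)
open import Data.Fin.Permutation using (Permutation′)
open import Data.Maybe using (just; nothing)
open import Data.Product using (_,_)
open import Data.Rational using (ℚ; 0ℚ; 1ℚ; _*_)
import Data.Rational as Q
open import Relation.Binary.PropositionalEquality using (sym; cong; subst)
open CoRounding using (0≤1; σ-consecutive; Jbetween-layout; PrCoRounded≤pairProduct)

-- For k outside [1, t - 1], σ is undefined at k or k + 1 and PrZ, δ default to 0, 1.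
lemma2p4 : (n : ℕ) (P A : Fin n → ℚ)
             → (∀ i → 0ℚ Q.≤ P i) → (∀ i → P i Q.≤ 1ℚ)
             → (∀ i → 0ℚ Q.< A i)
             → (∀ i j → A i Q.≤ (1ℚ Q.+ 1ℚ) * A j)
             → (I : Subset n) (π : Permutation′ n) (k : ℕ)
             → 1 ≤ k → k < ∣ I ∣
             → PrZ P A I π k Q.≤ δ P I π k
lemma2p4 n P A P≥0 P≤1 A>0 A≤2A I π k _ _ with σ π I k in σk | σ π I (suc k) in σk+1
... | just u  | just v
  with pre , mid , post , layout , mid∉I ← σ-consecutive π I k σk σk+1 =
  subst (PrCoRounded A π P u v Q.≤_) (cong (pairProduct P) (sym (Jbetween-layout π I u v pre mid post layout mid∉I)))
        (PrCoRounded≤pairProduct P A P≥0 P≤1 A>0 A≤2A π u v pre mid post layout)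
... | just _  | nothing = 0≤1
... | nothing | _       = 0≤1
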